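{- Let $p$ be a prime, let $e\geq 2$, $d\geq 2$ be integers, let $\lambda\in\{1,\dots,\min(e,d-1)\}$, let $\alpha=(\alpha_1,\dots,\alpha_d)\in\mathcal R_\lambda(d,e)$ and $\mu=\mu(\alpha)$. The inequality $$\sum_{i=1}^d p^{\alpha_i}x_i\geq\lambda p^{\mu+1}+(d-\lambda)p^{\mu}$$ holds with equality on the set $$S_\alpha=\{(p^{\mu-\alpha_1+\epsilon_1},\dots,p^{\mu-\alpha_d+\epsilon_d}) : (\epsilon_1,\dots,\epsilon_d)\in\{0,1\}^d,\ \textstyle\sum_i\epsilon_i=\lambda\}$$ of vertices of $\mathcal P(p^e,d)$. The convex hull of $S_\alpha$ is a facet of $\mathcal P(p^e,d)$ which is affinely equivalent to the $(d-1)$-dimensional hypersimplex $\Delta(\lambda)$.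
   Context: A $d$-dimensional vector-factorisation of $p^e$ is a vector $(v_1,\dots,v_d)$ of positive integers with $v_1\cdots v_d=p^e$. $\mathcal P(p^e,d)$ denotes the convex hull in $\mathbb R^d$ of all $d$-dimensional vector-factorisations of $p^e$. For $\lambda\in\{1,\dots,\min(e,d-1)\}$, $\mathcal R_\lambda(d,e)$ is the set of all $\alpha=(\alpha_1,\dots,\alpha_d)$ with non-negative integer entries such that $\min_i\alpha_i=0$, $d\cdot\max_i\alpha_i<e+\sum_{i=1}^d\alpha_i$, and $e+\sum_{i=1}^d\alpha_i\equiv\lambda\pmod d$; for such $\alpha$, $\mu(\alpha)$ is defined by $\mu(\alpha)d+\lambda=e+\sum_i\alpha_i$. The hypersimplex is $\Delta(\lambda)=\mathrm{Conv}\{\epsilon\in\{0,1\}^d:\sum_i\epsilon_i=\lambda\}$.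
   Formalization: The polytope 𝒫(p^e,d), the convex hull of S_α and the hypersimplex Δ(λ) lie in ℚ^d rather than ℝ^d, and the affine equivalence is given by an invertible affine map with rational coefficients. -}

module Defs where

open import Data.Nat as ℕ using (ℕ; zero; suc)
open import Data.Bool using (Bool; true; false; if_then_else_)
open import Data.Fin using (Fin)
open import Data.Integer using (+_)
open import Data.Rational using (ℚ; 0ℚ; 1ℚ; _+_; _*_; _≤_; _/_)
open import Data.Product using (Σ; ∃; _×_; _,_)
open import Relation.Binary.PropositionalEquality using (_≡_; _≢_)
open import Relation.Nullary using (¬_)

-- points of ℚ^d (the polytopes in question are rational)
Pt : ℕ → Set
Pt d = Fin d → ℚ

ℕ→ℚ : ℕ → ℚ
ℕ→ℚ n = (+ n) / 1

sumℕ : ∀ {n} → (Fin n → ℕ) → ℕ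
sumℕ {zero} f = 0
sumℕ {suc n} f = f Fin.zero ℕ.+ sumℕ (λ i → f (Fin.suc i))

prodℕ : ∀ {n} → (Fin n → ℕ) → ℕ
prodℕ {zero} f = 1
prodℕ {suc n} f = f Fin.zero ℕ.* prodℕ (λ i → f (Fin.suc i))

sumℚ : ∀ {n} → (Fin n → ℚ) → ℚ
sumℚ {zero} f = 0ℚ
sumℚ {suc n} f = f Fin.zero + sumℚ (λ i → f (Fin.suc i))

b2n : Bool → ℕ
b2n true = 1
b2n false = 0

count : ∀ {d} → (Fin d → Bool) → ℕ
count ε = sumℕ (λ i → b2n (ε i))

_≐_ : ∀ {d} → Pt d → Pt d → Set
x ≐ y = ∀ i → x i ≡ y i

PSet : ℕ → Set₁
PSet d = Pt d → Set

Conv : ∀ {d} → PSet d → PSet d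
Conv {d} S x =
  Σ ℕ λ n → Σ (Fin n → ℚ) λ w → Σ (Fin n → Pt d) λ v →
    (∀ j → S (v j)) × (∀ j → 0ℚ ≤ w j) × (sumℚ w ≡ 1ℚ) ×
    (x ≐ (λ i → sumℚ (λ j → w j * v j i)))

VecFact : ℕ → (d : ℕ) → PSet d
VecFact N d x = Σ (Fin d → ℕ) λ v →
  (∀ i → 1 ℕ.≤ v i) × (prodℕ v ≡ N) × (x ≐ (λ i → ℕ→ℚ (v i)))

𝒫 : ℕ → (d : ℕ) → PSet d
𝒫 N d = Conv (VecFact N d)

IsVertex : ∀ {d} → PSet d → Pt d → Set
IsVertex {d} P s = P s × (∀ (x y : Pt d) (t : ℚ) → P x → P y →
  Data.Rational._<_ 0ℚ t → Data.Rational._<_ t 1ℚ →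
  s ≐ (λ i → t * x i + (1ℚ Data.Rational.- t) * y i) → (x ≐ s) × (y ≐ s))

AffInd : ∀ {d k} → (Fin k → Pt d) → Set
AffInd {d} {k} v = ∀ (c : Fin k → ℚ) → sumℚ c ≡ 0ℚ →
  (∀ i → sumℚ (λ j → c j * v j i) ≡ 0ℚ) → ∀ j → c j ≡ 0ℚ

HasDim : ∀ {d} → PSet d → ℕ → Set
HasDim {d} X k =
  (Σ (Fin (suc k) → Pt d) λ v → (∀ j → X (v j)) × AffInd v) ×
  (∀ (v : Fin (suc (suc k)) → Pt d) → (∀ j → X (v j)) → ¬ AffInd v)

dot : ∀ {d} → Pt d → Pt d → ℚ
dot a x = sumℚ (λ i → a i * x i)

IsFace : ∀ {d} → PSet d → PSet d → Set
IsFace {d} F P = Σ (Pt d) λ a → Σ ℚ λ b →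
  (∀ x → P x → b ≤ dot a x) ×
  (∀ x → F x → P x × dot a x ≡ b) × (∀ x → P x → dot a x ≡ b → F x)

IsFacet : ∀ {d} → PSet d → PSet d → Set
IsFacet F P = IsFace F P × Σ ℕ λ k → HasDim P (suc k) × HasDim F k

affMap : ∀ {d} → (Fin d → Fin d → ℚ) → Pt d → Pt d → Pt d
affMap A b x i = sumℚ (λ j → A i j * x j) + b i

AffEquiv : ∀ {d} → PSet d → PSet d → Set
AffEquiv {d} X Y =
  Σ (Fin d → Fin d → ℚ) λ A → Σ (Pt d) λ b →
  Σ (Fin d → Fin d → ℚ) λ A' → Σ (Pt d) λ b' →
    (∀ x → affMap A' b' (affMap A b x) ≐ x) ×
    (∀ y → affMap A b (affMap A' b' y) ≐ y) ×
    (∀ x → X x → Y (affMap A b x)) ×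
    (∀ y → Y y → Σ (Pt d) λ x → X x × (affMap A b x ≐ y))

Hypersimplex : (d : ℕ) → ℕ → PSet d
Hypersimplex d l = Conv (λ x → Σ (Fin d → Bool) λ ε →
  (count ε ≡ l) × (x ≐ (λ i → ℕ→ℚ (b2n (ε i)))))

InR : (d e l : ℕ) → (Fin d → ℕ) → Set
InR d e l α =
  (Σ (Fin d) λ i → α i ≡ 0) ×
  (∀ i → d ℕ.* α i ℕ.< e ℕ.+ sumℕ α) ×
  (Σ ℕ λ q → e ℕ.+ sumℕ α ≡ q ℕ.* d ℕ.+ l)

-- S_α (μ ≥ α_i for α ∈ ℛ_λ, so ∸ is honest subtraction here)
Sα : ∀ {d} → ℕ → ℕ → ℕ → (Fin d → ℕ) → PSet d
Sα {d} p l μ α x = Σ (Fin d → Bool) λ ε →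
  (count ε ≡ l) × (x ≐ (λ i → ℕ→ℚ (p ℕ.^ (μ ℕ.∸ α i ℕ.+ b2n (ε i)))))

-- A vertex of 𝒫(p^e, d) is p^β with Σ β = e, where x ↦ Σ p^{α_i} x_i takes the value Σ p^{γ_i}
-- with γ = α + β and Σ γ = μ d + λ. By convexity p^γ lies on or above its chord over [μ, μ + 1],
-- touching it only at μ and μ + 1; summing over the coordinates gives
-- Σ p^{γ_i} ≥ λ p^{μ+1} + (d - λ) p^μ, with equality exactly when every γ_i ∈ {μ, μ + 1}, i.e. on S_α.
-- The map x_i ↦ (p^{α_i} x_i - p^μ) / ((p - 1) p^μ) sends S_α onto the vertices of Δ(λ), among which
-- there are d affinely independent ones, while the vertex with p^e in a coordinate other than one
-- where α vanishes lies off the hyperplane; so the face is a facet. Each point of S_α is a corner of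
-- the box ∏ [p^{μ-α_i}, p^{μ-α_i+1}] containing the face, hence a vertex of 𝒫.

module Submission where

open import Defs
open import Data.Nat using (ℕ; _+_; _*_; _^_; _∸_; _≤_; _⊓_)
open import Data.Nat.Primality using (Prime)
open import Data.Fin using (Fin)
open import Data.Rational using (ℚ)
open import Data.Product using (_×_)
open import Relation.Binary.PropositionalEquality using (_≡_)

open import Algebra.Bundles using (CommutativeMonoid)
import Algebra.Properties.CommutativeSemigroup as CommutativeSemigroupProperties
import Algebra.Properties.Group as GroupProperties
open import Data.Bool using (Bool; true; false; not; _xor_)
import Data.Bool.Properties as Bool
open import Data.Empty using (⊥)
open import Data.Fin as Fin using (toℕ)
import Data.Fin.Properties as Fin
import Data.Integer as ℤ
import Data.Integer.Properties as ℤ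
open import Data.Nat as ℕ using (zero; suc; _<_; z≤n; s≤s; _<ᵇ_; 2+)
open import Data.Nat.Coprimality as Coprimality using (Coprime; coprime-divisor)
open import Data.Nat.Divisibility using (_∣_; divides; _∣?_; ∣1⇒≡1; *-cancelˡ-∣; m∣m*n; n∣m*n; ∣-trans)
open import Data.Nat.Primality using (prime⇒nonZero; prime⇒nonTrivial; prime⇒irreducible)
import Data.Nat.Properties as ℕ
import Data.Nat.Solver
open import Data.Product as Product using (Σ; ∃; _,_; proj₁; proj₂)
open import Data.Rational as ℚ using (mkℚ; 0ℚ; 1ℚ)
import Data.Rational.Properties as ℚ
import Data.Rational.Solver
import Data.Rational.Unnormalised as ℚᵘ
import Data.Rational.Unnormalised.Properties as ℚᵘ
open import Data.Sum using (_⊎_; inj₁; inj₂; [_,_]′)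
open import Data.Vec.Functional using (_∷_)
open import Function using (_∘_)
open import Relation.Binary.Definitions using (tri<; tri≈; tri>)
open import Relation.Binary.PropositionalEquality
open import Relation.Nullary using (¬_; Dec; yes; no; does; contradiction)
open import Relation.Nullary.Decidable using (dec-true; dec-false)

module ℕ-Solver = Data.Nat.Solver.+-*-Solver
module ℚ-Solver = Data.Rational.Solver.+-*-Solver
module ℕ+ = CommutativeSemigroupProperties ℕ.+-commutativeSemigroup
module ℚ+ = CommutativeSemigroupProperties (CommutativeMonoid.commutativeSemigroup ℚ.+-0-commutativeMonoid)
module ℚ* = CommutativeSemigroupProperties (CommutativeMonoid.commutativeSemigroup ℚ.*-1-commutativeMonoid)
module ℚ+-Group = GroupProperties ℚ.+-0-group

ℕ→ℚ≡mkℚ : ∀ n → ℕ→ℚ n ≡ mkℚ (ℤ.+ n) 0 (Coprimality.sym (Coprimality.1-coprimeTo n))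
ℕ→ℚ≡mkℚ n = ℚ.normalize-coprime (Coprimality.sym (Coprimality.1-coprimeTo n))

toℚᵘ-ℕ→ℚ : ∀ n → ℚ.toℚᵘ (ℕ→ℚ n) ≡ ℚᵘ.mkℚᵘ (ℤ.+ n) 0
toℚᵘ-ℕ→ℚ n rewrite ℕ→ℚ≡mkℚ n = refl

ℕ→ℚ-homo-+ : ∀ m n → ℕ→ℚ (m + n) ≡ ℕ→ℚ m ℚ.+ ℕ→ℚ n
ℕ→ℚ-homo-+ m n = ℚ.toℚᵘ-injective (begin
  ℚ.toℚᵘ (ℕ→ℚ (m + n))
    ≈⟨ ℚᵘ.≃-reflexive (toℚᵘ-ℕ→ℚ (m + n)) ⟩
  ℚᵘ.mkℚᵘ (ℤ.+ (m + n)) 0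
    ≈⟨ ℚᵘ.*≡* (cong (ℤ._* ℤ.+ 1) (trans (ℤ.pos-+ m n)
         (sym (cong₂ ℤ._+_ (ℤ.*-identityʳ (ℤ.+ m)) (ℤ.*-identityʳ (ℤ.+ n)))))) ⟩
  ℚᵘ.mkℚᵘ (ℤ.+ m) 0 ℚᵘ.+ ℚᵘ.mkℚᵘ (ℤ.+ n) 0
    ≈⟨ ℚᵘ.≃-reflexive (cong₂ ℚᵘ._+_ (toℚᵘ-ℕ→ℚ m) (toℚᵘ-ℕ→ℚ n)) ⟨
  ℚ.toℚᵘ (ℕ→ℚ m) ℚᵘ.+ ℚ.toℚᵘ (ℕ→ℚ n)
    ≈⟨ ℚ.toℚᵘ-homo-+ (ℕ→ℚ m) (ℕ→ℚ n) ⟨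
  ℚ.toℚᵘ (ℕ→ℚ m ℚ.+ ℕ→ℚ n) ∎)
  where open import Relation.Binary.Reasoning.Setoid ℚᵘ.≃-setoid

ℕ→ℚ-homo-* : ∀ m n → ℕ→ℚ (m * n) ≡ ℕ→ℚ m ℚ.* ℕ→ℚ n
ℕ→ℚ-homo-* m n = ℚ.toℚᵘ-injective (begin
  ℚ.toℚᵘ (ℕ→ℚ (m * n))
    ≈⟨ ℚᵘ.≃-reflexive (toℚᵘ-ℕ→ℚ (m * n)) ⟩
  ℚᵘ.mkℚᵘ (ℤ.+ (m * n)) 0
    ≈⟨ ℚᵘ.*≡* (cong (ℤ._* ℤ.+ 1) (ℤ.pos-* m n)) ⟩
  ℚᵘ.mkℚᵘ (ℤ.+ m) 0 ℚᵘ.* ℚᵘ.mkℚᵘ (ℤ.+ n) 0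
    ≈⟨ ℚᵘ.≃-reflexive (cong₂ ℚᵘ._*_ (toℚᵘ-ℕ→ℚ m) (toℚᵘ-ℕ→ℚ n)) ⟨
  ℚ.toℚᵘ (ℕ→ℚ m) ℚᵘ.* ℚ.toℚᵘ (ℕ→ℚ n)
    ≈⟨ ℚ.toℚᵘ-homo-* (ℕ→ℚ m) (ℕ→ℚ n) ⟨
  ℚ.toℚᵘ (ℕ→ℚ m ℚ.* ℕ→ℚ n) ∎)
  where open import Relation.Binary.Reasoning.Setoid ℚᵘ.≃-setoid

ℕ→ℚ-mono-≤ : ∀ {m n} → m ≤ n → ℕ→ℚ m ℚ.≤ ℕ→ℚ n
ℕ→ℚ-mono-≤ {m} {n} m≤n rewrite ℕ→ℚ≡mkℚ m | ℕ→ℚ≡mkℚ n =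
  ℚ.*≤* (subst₂ ℤ._≤_ (sym (ℤ.*-identityʳ (ℤ.+ m))) (sym (ℤ.*-identityʳ (ℤ.+ n))) (ℤ.+≤+ m≤n))

ℕ→ℚ-cancel-≤ : ∀ {m n} → ℕ→ℚ m ℚ.≤ ℕ→ℚ n → m ≤ n
ℕ→ℚ-cancel-≤ {m} {n} le rewrite ℕ→ℚ≡mkℚ m | ℕ→ℚ≡mkℚ n with le
... | ℚ.*≤* m≤n = ℤ.drop‿+≤+ (subst₂ ℤ._≤_ (ℤ.*-identityʳ (ℤ.+ m)) (ℤ.*-identityʳ (ℤ.+ n)) m≤n)

ℕ→ℚ-injective : ∀ {m n} → ℕ→ℚ m ≡ ℕ→ℚ n → m ≡ n
ℕ→ℚ-injective eq =
  ℕ.≤-antisym (ℕ→ℚ-cancel-≤ (ℚ.≤-reflexive eq)) (ℕ→ℚ-cancel-≤ (ℚ.≤-reflexive (sym eq)))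

ℕ→ℚ-≢0 : ∀ {n} → 1 ≤ n → ℕ→ℚ n ≢ 0ℚ
ℕ→ℚ-≢0 {suc n} _ eq with () ← ℕ→ℚ-injective {suc n} {0} eq

*-cancelˡ-≡0 : ∀ {x y} → x ≢ 0ℚ → x ℚ.* y ≡ 0ℚ → y ≡ 0ℚ
*-cancelˡ-≡0 {x} {y} x≢0 xy≡0 = begin
  y                      ≡⟨ ℚ.*-identityˡ y ⟨
  1ℚ ℚ.* y               ≡⟨ cong (ℚ._* y) (ℚ.*-inverseˡ x) ⟨
  ℚ.1/ x ℚ.* x ℚ.* y     ≡⟨ ℚ.*-assoc (ℚ.1/ x) x y ⟩
  ℚ.1/ x ℚ.* (x ℚ.* y)   ≡⟨ cong (ℚ.1/ x ℚ.*_) xy≡0 ⟩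
  ℚ.1/ x ℚ.* 0ℚ          ≡⟨ ℚ.*-zeroʳ (ℚ.1/ x) ⟩
  0ℚ                     ∎
  where
  open ≡-Reasoning
  instance _ = ℚ.≢-nonZero x≢0

nonNeg+nonNeg≡0⇒≡0 : ∀ {x y} → 0ℚ ℚ.≤ x → 0ℚ ℚ.≤ y → x ℚ.+ y ≡ 0ℚ → x ≡ 0ℚ
nonNeg+nonNeg≡0⇒≡0 {x} 0≤x 0≤y x+y≡0 =
  ℚ.≤-antisym (subst₂ ℚ._≤_ (ℚ.+-identityʳ x) x+y≡0 (ℚ.+-monoʳ-≤ x 0≤y)) 0≤x

*-nonNeg : ∀ {x y} → 0ℚ ℚ.≤ x → 0ℚ ℚ.≤ y → 0ℚ ℚ.≤ x ℚ.* y
*-nonNeg {x} {y} 0≤x 0≤y =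
  ℚ.nonNegative⁻¹ _ {{ℚ.nonNeg*nonNeg⇒nonNeg x {{ℚ.nonNegative 0≤x}} y {{ℚ.nonNegative 0≤y}}}}

≤⇒0≤- : ∀ {x y} → x ℚ.≤ y → 0ℚ ℚ.≤ y ℚ.- x
≤⇒0≤- {x} {y} x≤y = subst (ℚ._≤ y ℚ.- x) (ℚ.+-inverseʳ x) (ℚ.+-monoˡ-≤ (ℚ.- x) x≤y)

<⇒0<- : ∀ {x y} → x ℚ.< y → 0ℚ ℚ.< y ℚ.- x
<⇒0<- {x} {y} x<y = subst (ℚ._< y ℚ.- x) (ℚ.+-inverseʳ x) (ℚ.+-monoˡ-< (ℚ.- x) x<y)

-≡0⇒≡ : ∀ {x y} → x ℚ.- y ≡ 0ℚ → x ≡ y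
-≡0⇒≡ = ℚ+-Group.x∙y⁻¹≈ε⇒x≈y _ _

*≡0⇒≡0⊎≡0 : ∀ {x y} → x ℚ.* y ≡ 0ℚ → x ≡ 0ℚ ⊎ y ≡ 0ℚ
*≡0⇒≡0⊎≡0 {x} xy≡0 = split (x ℚ.≟ 0ℚ)
  where
  split : Dec (x ≡ 0ℚ) → _
  split (yes x≡0) = inj₁ x≡0
  split (no  x≢0) = inj₂ (*-cancelˡ-≡0 x≢0 xy≡0)

*-≢0 : ∀ {x y} → x ≢ 0ℚ → y ≢ 0ℚ → x ℚ.* y ≢ 0ℚ
*-≢0 x≢0 y≢0 xy≡0 with *≡0⇒≡0⊎≡0 xy≡0
... | inj₁ x≡0 = x≢0 x≡0
... | inj₂ y≡0 = y≢0 y≡0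

1/-≢0 : ∀ {x} (x≢0 : x ≢ 0ℚ) → ℚ.1/_ x {{ℚ.≢-nonZero x≢0}} ≢ 0ℚ
1/-≢0 {x} x≢0 1/x≡0 = ℚ.1≢0 (begin
  1ℚ                  ≡⟨ ℚ.*-inverseʳ x {{ℚ.≢-nonZero x≢0}} ⟨
  x ℚ.* ℚ.1/_ x {{ℚ.≢-nonZero x≢0}} ≡⟨ cong (x ℚ.*_) 1/x≡0 ⟩
  x ℚ.* 0ℚ            ≡⟨ ℚ.*-zeroʳ x ⟩
  0ℚ                  ∎)
  where open ≡-Reasoning

sumℚ-cong : ∀ {n} {f g : Fin n → ℚ} → (∀ i → f i ≡ g i) → sumℚ f ≡ sumℚ g
sumℚ-cong {zero}  eq = refl
sumℚ-cong {suc n} eq = cong₂ ℚ._+_ (eq Fin.zero) (sumℚ-cong (λ i → eq (Fin.suc i)))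

sumℚ-zero : ∀ n → sumℚ {n} (λ _ → 0ℚ) ≡ 0ℚ
sumℚ-zero zero    = refl
sumℚ-zero (suc n) = cong (0ℚ ℚ.+_) (sumℚ-zero n)

sumℚ-zeroˡ : ∀ {n} (f : Fin n → ℚ) → sumℚ (λ i → 0ℚ ℚ.* f i) ≡ 0ℚ
sumℚ-zeroˡ {n} f = trans (sumℚ-cong (λ i → ℚ.*-zeroˡ (f i))) (sumℚ-zero n)

sumℚ-distrib-+ : ∀ {n} (f g : Fin n → ℚ) → sumℚ (λ i → f i ℚ.+ g i) ≡ sumℚ f ℚ.+ sumℚ g
sumℚ-distrib-+ {zero}  f g = refl
sumℚ-distrib-+ {suc n} f g
  rewrite sumℚ-distrib-+ (λ i → f (Fin.suc i)) (λ i → g (Fin.suc i)) =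
  ℚ+.interchange (f Fin.zero) (g Fin.zero) _ _

*-distribˡ-sumℚ : ∀ {n} (x : ℚ) (f : Fin n → ℚ) → x ℚ.* sumℚ f ≡ sumℚ (λ i → x ℚ.* f i)
*-distribˡ-sumℚ {zero}  x f = ℚ.*-zeroʳ x
*-distribˡ-sumℚ {suc n} x f =
  trans (ℚ.*-distribˡ-+ x _ _) (cong (x ℚ.* f Fin.zero ℚ.+_) (*-distribˡ-sumℚ x (λ i → f (Fin.suc i))))

*-distribʳ-sumℚ : ∀ {n} (x : ℚ) (f : Fin n → ℚ) → sumℚ f ℚ.* x ≡ sumℚ (λ i → f i ℚ.* x)
*-distribʳ-sumℚ x f =
  trans (ℚ.*-comm _ x) (trans (*-distribˡ-sumℚ x f) (sumℚ-cong (λ i → ℚ.*-comm x (f i))))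

neg-distrib-sumℚ : ∀ {n} (f : Fin n → ℚ) → ℚ.- sumℚ f ≡ sumℚ (λ i → ℚ.- f i)
neg-distrib-sumℚ {zero}  f = refl
neg-distrib-sumℚ {suc n} f =
  trans (ℚ.neg-distrib-+ (f Fin.zero) _) (cong (ℚ.- f Fin.zero ℚ.+_) (neg-distrib-sumℚ (λ i → f (Fin.suc i))))

sumℚ-comm : ∀ {m n} (f : Fin m → Fin n → ℚ) →
  sumℚ (λ i → sumℚ (λ j → f i j)) ≡ sumℚ (λ j → sumℚ (λ i → f i j))
sumℚ-comm {zero}  {n} f = sym (sumℚ-zero n)
sumℚ-comm {suc m} f rewrite sumℚ-comm (λ i j → f (Fin.suc i) j) =
  sym (sumℚ-distrib-+ (f Fin.zero) (λ j → sumℚ (λ i → f (Fin.suc i) j)))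

sumℚ-mono-≤ : ∀ {n} {f g : Fin n → ℚ} → (∀ i → f i ℚ.≤ g i) → sumℚ f ℚ.≤ sumℚ g
sumℚ-mono-≤ {zero}  le = ℚ.≤-refl
sumℚ-mono-≤ {suc n} le = ℚ.+-mono-≤ (le Fin.zero) (sumℚ-mono-≤ (λ i → le (Fin.suc i)))

sumℚ-nonNeg : ∀ {n} {f : Fin n → ℚ} → (∀ i → 0ℚ ℚ.≤ f i) → 0ℚ ℚ.≤ sumℚ f
sumℚ-nonNeg {n} {f} nonNeg = subst (ℚ._≤ sumℚ f) (sumℚ-zero n) (sumℚ-mono-≤ nonNeg)

sumℚ-nonNeg-≡0 : ∀ {n} {f : Fin n → ℚ} → (∀ i → 0ℚ ℚ.≤ f i) → sumℚ f ≡ 0ℚ →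
  ∀ i → f i ≡ 0ℚ
sumℚ-nonNeg-≡0 {suc n} {f} nonNeg sum≡0 Fin.zero =
  nonNeg+nonNeg≡0⇒≡0 (nonNeg Fin.zero) (sumℚ-nonNeg (λ i → nonNeg (Fin.suc i))) sum≡0
sumℚ-nonNeg-≡0 {suc n} {f} nonNeg sum≡0 (Fin.suc i) =
  sumℚ-nonNeg-≡0 (λ i → nonNeg (Fin.suc i))
    (nonNeg+nonNeg≡0⇒≡0 (sumℚ-nonNeg (λ i → nonNeg (Fin.suc i))) (nonNeg Fin.zero)
      (trans (ℚ.+-comm _ (f Fin.zero)) sum≡0)) i

sumℕ-cong : ∀ {n} {f g : Fin n → ℕ} → (∀ i → f i ≡ g i) → sumℕ f ≡ sumℕ g
sumℕ-cong {zero}  eq = refl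
sumℕ-cong {suc n} eq = cong₂ _+_ (eq Fin.zero) (sumℕ-cong (λ i → eq (Fin.suc i)))

sumℕ-const : ∀ n c → sumℕ {n} (λ _ → c) ≡ n * c
sumℕ-const zero    c = refl
sumℕ-const (suc n) c = cong (c +_) (sumℕ-const n c)

sumℕ-distrib-+ : ∀ {n} (f g : Fin n → ℕ) → sumℕ (λ i → f i + g i) ≡ sumℕ f + sumℕ g
sumℕ-distrib-+ {zero}  f g = refl
sumℕ-distrib-+ {suc n} f g
  rewrite sumℕ-distrib-+ (λ i → f (Fin.suc i)) (λ i → g (Fin.suc i)) =
  ℕ+.interchange (f Fin.zero) (g Fin.zero) _ _

*-distribʳ-sumℕ : ∀ {n} c (f : Fin n → ℕ) → sumℕ f * c ≡ sumℕ (λ i → f i * c)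
*-distribʳ-sumℕ {zero}  c f = refl
*-distribʳ-sumℕ {suc n} c f =
  trans (ℕ.*-distribʳ-+ c (f Fin.zero) _) (cong (f Fin.zero * c +_) (*-distribʳ-sumℕ c (λ i → f (Fin.suc i))))

sumℕ-mono-≤ : ∀ {n} {f g : Fin n → ℕ} → (∀ i → f i ≤ g i) → sumℕ f ≤ sumℕ g
sumℕ-mono-≤ {zero}  le = z≤n
sumℕ-mono-≤ {suc n} le = ℕ.+-mono-≤ (le Fin.zero) (sumℕ-mono-≤ (λ i → le (Fin.suc i)))

+-mono-≤-≡⇒≡ˡ : ∀ {a b c d} → a ≤ c → b ≤ d → a + b ≡ c + d → a ≡ c
+-mono-≤-≡⇒≡ˡ {a} {b} {c} {d} a≤c b≤d eq =
  ℕ.≤-antisym a≤c (ℕ.+-cancelʳ-≤ b c a (subst (c + b ≤_) (sym eq) (ℕ.+-monoʳ-≤ c b≤d)))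

sumℕ-mono-≤-≡⇒≡ : ∀ {n} {f g : Fin n → ℕ} → (∀ i → f i ≤ g i) → sumℕ f ≡ sumℕ g →
  ∀ i → f i ≡ g i
sumℕ-mono-≤-≡⇒≡ {suc n} le eq Fin.zero =
  +-mono-≤-≡⇒≡ˡ (le Fin.zero) (sumℕ-mono-≤ (λ i → le (Fin.suc i))) eq
sumℕ-mono-≤-≡⇒≡ {suc n} {f} {g} le eq (Fin.suc i) =
  sumℕ-mono-≤-≡⇒≡ (λ i → le (Fin.suc i))
    (+-mono-≤-≡⇒≡ˡ (sumℕ-mono-≤ (λ i → le (Fin.suc i))) (le Fin.zero)
      (trans (ℕ.+-comm _ (f Fin.zero)) (trans eq (ℕ.+-comm (g Fin.zero) _)))) i

ℕ→ℚ-homo-sum : ∀ {n} (f : Fin n → ℕ) → ℕ→ℚ (sumℕ f) ≡ sumℚ (λ i → ℕ→ℚ (f i))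
ℕ→ℚ-homo-sum {zero}  f = refl
ℕ→ℚ-homo-sum {suc n} f =
  trans (ℕ→ℚ-homo-+ (f Fin.zero) _)
        (cong (ℕ→ℚ (f Fin.zero) ℚ.+_) (ℕ→ℚ-homo-sum (λ i → f (Fin.suc i))))

𝟙 : Bool → ℚ
𝟙 b = ℕ→ℚ (b2n b)

𝟙-not : ∀ b → 𝟙 (not b) ≡ 1ℚ ℚ.- 𝟙 b
𝟙-not true  = refl
𝟙-not false = refl

δᵇ : ∀ {n} → Fin n → Fin n → Bool
δᵇ i j = does (i Fin.≟ j)

sumℚ-δᵇ : ∀ {n} (f : Fin n → ℚ) i → sumℚ (λ j → 𝟙 (δᵇ j i) ℚ.* f j) ≡ f i
sumℚ-δᵇ {suc n} f Fin.zero =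
  trans (cong₂ ℚ._+_ (ℚ.*-identityˡ (f Fin.zero)) (sumℚ-zeroˡ (λ j → f (Fin.suc j))))
        (ℚ.+-identityʳ (f Fin.zero))
sumℚ-δᵇ {suc n} f (Fin.suc i) =
  trans (cong₂ ℚ._+_ (ℚ.*-zeroˡ (f Fin.zero)) (sumℚ-δᵇ (λ j → f (Fin.suc j)) i)) (ℚ.+-identityˡ _)

count-false : ∀ n → count {n} (λ _ → false) ≡ 0
count-false n = trans (sumℕ-const n 0) (ℕ.*-zeroʳ n)

count-δᵇ : ∀ {n} (j : Fin n) → count (δᵇ j) ≡ 1
count-δᵇ {suc n} Fin.zero    = cong suc (count-false n)
count-δᵇ {suc n} (Fin.suc j) = count-δᵇ j

initialSegment : ∀ {n} → ℕ → Fin n → Bool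
initialSegment L i = toℕ i <ᵇ L

count-initialSegment : ∀ {n} L → L ≤ n → count {n} (initialSegment L) ≡ L
count-initialSegment {n}     zero    _         = count-false n
count-initialSegment {suc n} (suc L) (s≤s L≤n) = cong suc (count-initialSegment L L≤n)

count-toggle : ∀ {n} (j : Fin n) (ε : Fin n → Bool) →
  count (λ i → δᵇ j i xor ε i) + b2n (ε j) ≡ count ε + b2n (not (ε j))
count-toggle Fin.zero ε =
  ℕ+.xy∙z≈zy∙x (b2n (not (ε Fin.zero))) (count (λ i → ε (Fin.suc i))) (b2n (ε Fin.zero))
count-toggle (Fin.suc j) ε = begin
  (b2n (ε Fin.zero) + count (λ i → δᵇ j i xor ε (Fin.suc i))) + b2n (ε (Fin.suc j))
    ≡⟨ ℕ.+-assoc (b2n (ε Fin.zero)) _ _ ⟩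
  b2n (ε Fin.zero) + (count (λ i → δᵇ j i xor ε (Fin.suc i)) + b2n (ε (Fin.suc j)))
    ≡⟨ cong (b2n (ε Fin.zero) +_) (count-toggle j (λ i → ε (Fin.suc i))) ⟩
  b2n (ε Fin.zero) + (count (λ i → ε (Fin.suc i)) + b2n (not (ε (Fin.suc j))))
    ≡⟨ ℕ.+-assoc (b2n (ε Fin.zero)) _ _ ⟨
  count ε + b2n (not (ε (Fin.suc j))) ∎
  where open ≡-Reasoning

-- Linear and affine dependence

combination : ∀ {m n} → (Fin m → ℚ) → (Fin m → Pt n) → Pt n
combination c v i = sumℚ (λ j → c j ℚ.* v j i)

dot-cong : ∀ {n} (a : Pt n) {x y : Pt n} → x ≐ y → dot a x ≡ dot a y
dot-cong a x≐y = sumℚ-cong (λ i → cong (a i ℚ.*_) (x≐y i))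

dot-combination : ∀ {m n} (a : Pt n) (c : Fin m → ℚ) (v : Fin m → Pt n) →
  dot a (combination c v) ≡ sumℚ (λ j → c j ℚ.* dot a (v j))
dot-combination a c v = begin
  sumℚ (λ i → a i ℚ.* sumℚ (λ j → c j ℚ.* v j i))
    ≡⟨ sumℚ-cong (λ i → *-distribˡ-sumℚ (a i) (λ j → c j ℚ.* v j i)) ⟩
  sumℚ (λ i → sumℚ (λ j → a i ℚ.* (c j ℚ.* v j i)))
    ≡⟨ sumℚ-comm (λ i j → a i ℚ.* (c j ℚ.* v j i)) ⟩
  sumℚ (λ j → sumℚ (λ i → a i ℚ.* (c j ℚ.* v j i)))
    ≡⟨ sumℚ-cong (λ j → sumℚ-cong (λ i → ℚ*.x∙yz≈y∙xz (a i) (c j) (v j i))) ⟩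
  sumℚ (λ j → sumℚ (λ i → c j ℚ.* (a i ℚ.* v j i)))
    ≡⟨ sumℚ-cong (λ j → *-distribˡ-sumℚ (c j) (λ i → a i ℚ.* v j i)) ⟨
  sumℚ (λ j → c j ℚ.* dot a (v j)) ∎
  where open ≡-Reasoning

dot-zero : ∀ {n} (a : Pt n) {x : Pt n} → (∀ i → x i ≡ 0ℚ) → dot a x ≡ 0ℚ
dot-zero {n} a x≡0 =
  trans (sumℚ-cong (λ i → trans (cong (a i ℚ.*_) (x≡0 i)) (ℚ.*-zeroʳ (a i)))) (sumℚ-zero n)

LinearlyDependent : ∀ {m n} → (Fin m → Pt n) → Set
LinearlyDependent {m} v =
  Σ (Fin m → ℚ) λ c → (∃ λ j → c j ≢ 0ℚ) × (∀ i → combination c v i ≡ 0ℚ)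

module PivotElimination {n} (v : Fin (suc (suc n)) → Pt (suc n))
  (i₀ : Fin (suc n)) (pivot≢0 : v Fin.zero i₀ ≢ 0ℚ) where

  instance _ = ℚ.≢-nonZero pivot≢0

  ratio : Fin (suc n) → ℚ
  ratio k = v (Fin.suc k) i₀ ℚ.* ℚ.1/ v Fin.zero i₀

  reduced : Fin (suc n) → Pt (suc n)
  reduced k i = v (Fin.suc k) i ℚ.- ratio k ℚ.* v Fin.zero i

  reduced-pivot : ∀ k → reduced k i₀ ≡ 0ℚ
  reduced-pivot k = trans (cong (λ t → vₖ ℚ.- t) ratio*pivot) (ℚ.+-inverseʳ vₖ)
    where
    vₖ = v (Fin.suc k) i₀
    ratio*pivot : ratio k ℚ.* v Fin.zero i₀ ≡ vₖ
    ratio*pivot = trans (ℚ.*-assoc vₖ _ _)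
      (trans (cong (vₖ ℚ.*_) (ℚ.*-inverseˡ (v Fin.zero i₀))) (ℚ.*-identityʳ vₖ))

  liftCoefficients : (Fin (suc n) → ℚ) → Fin (suc (suc n)) → ℚ
  liftCoefficients c = ℚ.- sumℚ (λ k → c k ℚ.* ratio k) ∷ c

  combination-reduced : ∀ c i → combination c reduced i ≡ combination (liftCoefficients c) v i
  combination-reduced c i = begin
    sumℚ (λ k → c k ℚ.* (v (Fin.suc k) i ℚ.- ratio k ℚ.* v₀))
      ≡⟨ sumℚ-cong (λ k → solve 4 (λ c x r y → c :* (x :- r :* y) := c :* x :+ (:- (c :* r)) :* y)
                                  refl (c k) (v (Fin.suc k) i) (ratio k) v₀) ⟩
    sumℚ (λ k → c k ℚ.* v (Fin.suc k) i ℚ.+ ℚ.- (c k ℚ.* ratio k) ℚ.* v₀)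
      ≡⟨ sumℚ-distrib-+ (λ k → c k ℚ.* v (Fin.suc k) i) (λ k → ℚ.- (c k ℚ.* ratio k) ℚ.* v₀) ⟩
    sumℚ (λ k → c k ℚ.* v (Fin.suc k) i) ℚ.+ sumℚ (λ k → ℚ.- (c k ℚ.* ratio k) ℚ.* v₀)
      ≡⟨ cong (sumℚ (λ k → c k ℚ.* v (Fin.suc k) i) ℚ.+_) (begin
           sumℚ (λ k → ℚ.- (c k ℚ.* ratio k) ℚ.* v₀)
             ≡⟨ *-distribʳ-sumℚ v₀ (λ k → ℚ.- (c k ℚ.* ratio k)) ⟨
           sumℚ (λ k → ℚ.- (c k ℚ.* ratio k)) ℚ.* v₀
             ≡⟨ cong (ℚ._* v₀) (neg-distrib-sumℚ (λ k → c k ℚ.* ratio k)) ⟨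
           liftCoefficients c Fin.zero ℚ.* v₀ ∎) ⟩
    sumℚ (λ k → c k ℚ.* v (Fin.suc k) i) ℚ.+ liftCoefficients c Fin.zero ℚ.* v₀
      ≡⟨ ℚ.+-comm (sumℚ (λ k → c k ℚ.* v (Fin.suc k) i)) _ ⟩
    combination (liftCoefficients c) v i ∎
    where
    open ≡-Reasoning
    open ℚ-Solver
    v₀ = v Fin.zero i

  lift : LinearlyDependent (λ k i → reduced k (Fin.punchIn i₀ i)) → LinearlyDependent v
  lift (c , (j , cⱼ≢0) , c-kills) = liftCoefficients c , (Fin.suc j , cⱼ≢0) , kills
    where
    kills-reduced : ∀ i → combination c reduced i ≡ 0ℚ
    kills-reduced i with i Fin.≟ i₀
    ... | yes refl = trans (sumℚ-cong (λ k → trans (cong (c k ℚ.*_) (reduced-pivot k)) (ℚ.*-zeroʳ (c k))))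
                           (sumℚ-zero (suc n))
    ... | no i≢i₀ = subst (λ i → combination c reduced i ≡ 0ℚ)
                      (Fin.punchIn-punchOut (i≢i₀ ∘ sym)) (c-kills (Fin.punchOut (i≢i₀ ∘ sym)))
    kills : ∀ i → combination (liftCoefficients c) v i ≡ 0ℚ
    kills i = trans (sym (combination-reduced c i)) (kills-reduced i)

linearlyDependent : ∀ n (v : Fin (suc n) → Pt n) → LinearlyDependent v
linearlyDependent zero v = (λ _ → 1ℚ) , (Fin.zero , ℚ.1≢0) , λ ()
linearlyDependent (suc n) v with Fin.all? (λ i → v Fin.zero i ℚ.≟ 0ℚ)
... | yes v₀≡0 = (1ℚ ∷ λ _ → 0ℚ) , (Fin.zero , ℚ.1≢0) , λ i →
  trans (cong₂ ℚ._+_ (trans (ℚ.*-identityˡ _) (v₀≡0 i)) (sumℚ-zeroˡ (λ k → v (Fin.suc k) i)))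
        (ℚ.+-identityʳ 0ℚ)
... | no ¬v₀≡0 with Fin.¬∀⟶∃¬ _ _ (λ i → v Fin.zero i ℚ.≟ 0ℚ) ¬v₀≡0
...   | i₀ , pivot≢0 = lift (linearlyDependent n (λ k i → reduced k (Fin.punchIn i₀ i)))
  where open PivotElimination v i₀ pivot≢0

affinelyDependent : ∀ {n} (v : Fin (suc (suc n)) → Pt n) → ¬ AffInd v
affinelyDependent {n} v independent = refute (linearlyDependent (suc n) (λ j → 1ℚ ∷ v j))
  where
  refute : LinearlyDependent (λ j → 1ℚ ∷ v j) → ⊥
  refute (c , (j , cⱼ≢0) , c-kills) = cⱼ≢0 (independent c Σc≡0 c-kills-v j)
    where
    Σc≡0 : sumℚ c ≡ 0ℚ
    Σc≡0 = trans (sumℚ-cong (λ j → sym (ℚ.*-identityʳ (c j)))) (c-kills Fin.zero)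
    c-kills-v : ∀ i → combination c v i ≡ 0ℚ
    c-kills-v i = c-kills (Fin.suc i)

hyperplane⇒affinelyDependent : ∀ {n} (a : Pt n) {b : ℚ} → b ≢ 0ℚ →
  (v : Fin (suc n) → Pt n) → (∀ j → dot a (v j) ≡ b) → ¬ AffInd v
hyperplane⇒affinelyDependent {n} a {b} b≢0 v on-plane independent = refute (linearlyDependent n v)
  where
  refute : LinearlyDependent v → ⊥
  refute (c , (j , cⱼ≢0) , c-kills) = cⱼ≢0 (independent c Σc≡0 c-kills j)
    where
    b*Σc≡0 : b ℚ.* sumℚ c ≡ 0ℚ
    b*Σc≡0 = begin
      b ℚ.* sumℚ c                         ≡⟨ ℚ.*-comm b (sumℚ c) ⟩
      sumℚ c ℚ.* b                         ≡⟨ *-distribʳ-sumℚ b c ⟩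
      sumℚ (λ j → c j ℚ.* b)               ≡⟨ sumℚ-cong (λ j → cong (c j ℚ.*_) (on-plane j)) ⟨
      sumℚ (λ j → c j ℚ.* dot a (v j))     ≡⟨ dot-combination a c v ⟨
      dot a (combination c v)              ≡⟨ dot-zero a c-kills ⟩
      0ℚ                                   ∎
      where open ≡-Reasoning
    Σc≡0 : sumℚ c ≡ 0ℚ
    Σc≡0 = *-cancelˡ-≡0 b≢0 b*Σc≡0

AffInd-∷ : ∀ {n k} (a : Pt n) {b : ℚ} (z : Pt n) (v : Fin k → Pt n) →
  (∀ j → dot a (v j) ≡ b) → dot a z ≢ b → AffInd v → AffInd (z ∷ v)
AffInd-∷ a {b} z v on-plane off-plane independent c Σc≡0 c-kills = coefficients≡0
  where
  c₀ = c Fin.zero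
  cᵥ : Fin _ → ℚ
  cᵥ j = c (Fin.suc j)
  Σcᵥ≡-c₀ : sumℚ cᵥ ≡ ℚ.- c₀
  Σcᵥ≡-c₀ = ℚ+-Group.inverseʳ-unique c₀ (sumℚ cᵥ) Σc≡0
  [dot-b]*c₀≡0 : (dot a z ℚ.- b) ℚ.* c₀ ≡ 0ℚ
  [dot-b]*c₀≡0 = begin
    (dot a z ℚ.- b) ℚ.* c₀
      ≡⟨ solve 3 (λ x b c → (x :- b) :* c := c :* x :+ (:- c) :* b) refl (dot a z) b c₀ ⟩
    c₀ ℚ.* dot a z ℚ.+ ℚ.- c₀ ℚ.* b
      ≡⟨ cong (λ t → c₀ ℚ.* dot a z ℚ.+ t ℚ.* b) Σcᵥ≡-c₀ ⟨
    c₀ ℚ.* dot a z ℚ.+ sumℚ cᵥ ℚ.* b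
      ≡⟨ cong (c₀ ℚ.* dot a z ℚ.+_) (*-distribʳ-sumℚ b cᵥ) ⟩
    c₀ ℚ.* dot a z ℚ.+ sumℚ (λ j → cᵥ j ℚ.* b)
      ≡⟨ cong (c₀ ℚ.* dot a z ℚ.+_) (sumℚ-cong (λ j → cong (cᵥ j ℚ.*_) (on-plane j))) ⟨
    sumℚ (λ j → c j ℚ.* dot a ((z ∷ v) j))
      ≡⟨ dot-combination a c (z ∷ v) ⟨
    dot a (combination c (z ∷ v))
      ≡⟨ dot-zero a c-kills ⟩
    0ℚ ∎
    where
      open ≡-Reasoning
      open ℚ-Solver
  c₀≡0 : c₀ ≡ 0ℚ
  c₀≡0 = *-cancelˡ-≡0 (off-plane ∘ -≡0⇒≡) [dot-b]*c₀≡0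
  Σcᵥ≡0 : sumℚ cᵥ ≡ 0ℚ
  Σcᵥ≡0 = trans Σcᵥ≡-c₀ (cong ℚ.-_ c₀≡0)
  cᵥ-kills : ∀ i → combination cᵥ v i ≡ 0ℚ
  cᵥ-kills i = begin
    combination cᵥ v i                       ≡⟨ ℚ.+-identityˡ _ ⟨
    0ℚ ℚ.+ combination cᵥ v i                ≡⟨ cong (ℚ._+ combination cᵥ v i) (ℚ.*-zeroˡ (z i)) ⟨
    0ℚ ℚ.* z i ℚ.+ combination cᵥ v i        ≡⟨ cong (λ t → t ℚ.* z i ℚ.+ combination cᵥ v i) c₀≡0 ⟨
    combination c (z ∷ v) i                  ≡⟨ c-kills i ⟩
    0ℚ                                       ∎
    where open ≡-Reasoning
  coefficients≡0 : ∀ j → c j ≡ 0ℚ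
  coefficients≡0 Fin.zero    = c₀≡0
  coefficients≡0 (Fin.suc j) = independent cᵥ Σcᵥ≡0 cᵥ-kills j

-- Convex combinations and vertices

mix : ℚ → ℚ → ℚ → ℚ
mix t x y = t ℚ.* x ℚ.+ (1ℚ ℚ.- t) ℚ.* y

mix-nonNeg-≡0 : ∀ {t x y} → 0ℚ ℚ.< t → t ℚ.< 1ℚ → 0ℚ ℚ.≤ x → 0ℚ ℚ.≤ y →
  mix t x y ≡ 0ℚ → x ≡ 0ℚ × y ≡ 0ℚ
mix-nonNeg-≡0 {t} {x} {y} 0<t t<1 0≤x 0≤y mix≡0 =
  *-cancelˡ-≡0 (λ t≡0 → ℚ.<-irrefl (sym t≡0) 0<t) tx≡0 ,
  *-cancelˡ-≡0 (λ 1-t≡0 → ℚ.<-irrefl (sym 1-t≡0) 0<1-t) [1-t]y≡0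
  where
  0<1-t = <⇒0<- t<1
  0≤tx = *-nonNeg (ℚ.<⇒≤ 0<t) 0≤x
  0≤[1-t]y = *-nonNeg (ℚ.<⇒≤ 0<1-t) 0≤y
  tx≡0 = nonNeg+nonNeg≡0⇒≡0 0≤tx 0≤[1-t]y mix≡0
  [1-t]y≡0 = nonNeg+nonNeg≡0⇒≡0 0≤[1-t]y 0≤tx (trans (ℚ.+-comm _ (t ℚ.* x)) mix≡0)

mix-translate : ∀ t x y b → mix t (x ℚ.- b) (y ℚ.- b) ≡ mix t x y ℚ.- b
mix-translate = solve 4 (λ t x y b → t :* (x :- b) :+ (con 1ℚ :- t) :* (y :- b)
                           := (t :* x :+ (con 1ℚ :- t) :* y) :- b) refl
  where open ℚ-Solver

mix-reflect : ∀ t x y b → mix t (b ℚ.- x) (b ℚ.- y) ≡ b ℚ.- mix t x y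
mix-reflect = solve 4 (λ t x y b → t :* (b :- x) :+ (con 1ℚ :- t) :* (b :- y)
                                 := b :- (t :* x :+ (con 1ℚ :- t) :* y)) refl
  where open ℚ-Solver

mix-lowerBound-≡ : ∀ {t x y b} → 0ℚ ℚ.< t → t ℚ.< 1ℚ → b ℚ.≤ x → b ℚ.≤ y →
  mix t x y ≡ b → x ≡ b × y ≡ b
mix-lowerBound-≡ {t} {x} {y} {b} 0<t t<1 b≤x b≤y mix≡b =
  Product.map -≡0⇒≡ -≡0⇒≡ (mix-nonNeg-≡0 0<t t<1 (≤⇒0≤- b≤x) (≤⇒0≤- b≤y) excess≡0)
  where
  excess≡0 : mix t (x ℚ.- b) (y ℚ.- b) ≡ 0ℚ
  excess≡0 = trans (mix-translate t x y b) (trans (cong (ℚ._- b) mix≡b) (ℚ.+-inverseʳ b))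

mix-upperBound-≡ : ∀ {t x y b} → 0ℚ ℚ.< t → t ℚ.< 1ℚ → x ℚ.≤ b → y ℚ.≤ b →
  mix t x y ≡ b → x ≡ b × y ≡ b
mix-upperBound-≡ {t} {x} {y} {b} 0<t t<1 x≤b y≤b mix≡b =
  Product.map (sym ∘ -≡0⇒≡) (sym ∘ -≡0⇒≡)
    (mix-nonNeg-≡0 0<t t<1 (≤⇒0≤- x≤b) (≤⇒0≤- y≤b) slack≡0)
  where
  slack≡0 : mix t (b ℚ.- x) (b ℚ.- y) ≡ 0ℚ
  slack≡0 = trans (mix-reflect t x y b) (trans (cong (λ m → b ℚ.- m) mix≡b) (ℚ.+-inverseʳ b))

mix-endpoint : ∀ {t x y lo hi c} → 0ℚ ℚ.< t → t ℚ.< 1ℚ →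
  lo ℚ.≤ x × x ℚ.≤ hi → lo ℚ.≤ y × y ℚ.≤ hi → c ≡ lo ⊎ c ≡ hi →
  mix t x y ≡ c → x ≡ c × y ≡ c
mix-endpoint 0<t t<1 (lo≤x , _) (lo≤y , _) (inj₁ refl) = mix-lowerBound-≡ 0<t t<1 lo≤x lo≤y
mix-endpoint 0<t t<1 (_ , x≤hi) (_ , y≤hi) (inj₂ refl) = mix-upperBound-≡ 0<t t<1 x≤hi y≤hi

Conv-mono : ∀ {d} {S T : PSet d} → (∀ x → S x → T x) → ∀ x → Conv S x → Conv T x
Conv-mono S⊆T x (n , w , v , Sv , w≥0 , Σw≡1 , x≐) =
  n , w , v , (λ j → S⊆T (v j) (Sv j)) , w≥0 , Σw≡1 , x≐

⊆-Conv : ∀ {d} {S : PSet d} x → S x → Conv S x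
⊆-Conv x Sx =
  1 , (λ _ → 1ℚ) , (λ _ → x) , (λ _ → Sx) , (λ _ → ℚ.nonNegative⁻¹ 1ℚ) , refl ,
  (λ i → sym (trans (ℚ.+-identityʳ _) (ℚ.*-identityˡ (x i))))

Conv-resp-≐ : ∀ {d} {S : PSet d} {x y : Pt d} → x ≐ y → Conv S x → Conv S y
Conv-resp-≐ x≐y (n , w , v , Sv , w≥0 , Σw≡1 , x≐) =
  n , w , v , Sv , w≥0 , Σw≡1 , λ i → trans (sym (x≐y i)) (x≐ i)

convexCombination-const : ∀ {n} (w : Fin n → ℚ) → sumℚ w ≡ 1ℚ → ∀ c → sumℚ (λ j → w j ℚ.* c) ≡ c
convexCombination-const w Σw≡1 c =
  trans (sym (*-distribʳ-sumℚ c w)) (trans (cong (ℚ._* c) Σw≡1) (ℚ.*-identityˡ c))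

convexCombination-mono-≤ : ∀ {n} {w f g : Fin n → ℚ} → (∀ j → 0ℚ ℚ.≤ w j) →
  (∀ j → f j ℚ.≤ g j) → sumℚ (λ j → w j ℚ.* f j) ℚ.≤ sumℚ (λ j → w j ℚ.* g j)
convexCombination-mono-≤ {w = w} w≥0 f≤g =
  sumℚ-mono-≤ (λ j → ℚ.*-monoˡ-≤-nonNeg (w j) {{ℚ.nonNegative (w≥0 j)}} (f≤g j))

convexCombination-translate : ∀ {n} (w : Fin n → ℚ) → sumℚ w ≡ 1ℚ → ∀ (f : Fin n → ℚ) c →
  sumℚ (λ j → w j ℚ.* (f j ℚ.- c)) ≡ sumℚ (λ j → w j ℚ.* f j) ℚ.- c
convexCombination-translate w Σw≡1 f c = begin
  sumℚ (λ j → w j ℚ.* (f j ℚ.- c))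
    ≡⟨ sumℚ-cong (λ j → trans (ℚ.*-distribˡ-+ (w j) (f j) (ℚ.- c))
                              (cong (w j ℚ.* f j ℚ.+_) (sym (ℚ.neg-distribʳ-* (w j) c)))) ⟩
  sumℚ (λ j → w j ℚ.* f j ℚ.+ ℚ.- (w j ℚ.* c))
    ≡⟨ sumℚ-distrib-+ (λ j → w j ℚ.* f j) (λ j → ℚ.- (w j ℚ.* c)) ⟩
  sumℚ (λ j → w j ℚ.* f j) ℚ.+ sumℚ (λ j → ℚ.- (w j ℚ.* c))
    ≡⟨ cong (sumℚ (λ j → w j ℚ.* f j) ℚ.+_)
         (trans (sym (neg-distrib-sumℚ (λ j → w j ℚ.* c))) (cong ℚ.-_ (convexCombination-const w Σw≡1 c))) ⟩
  sumℚ (λ j → w j ℚ.* f j) ℚ.- c ∎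
  where open ≡-Reasoning

Conv-lowerBound : ∀ {d} {S : PSet d} (a : Pt d) {b} → (∀ s → S s → b ℚ.≤ dot a s) →
  ∀ x → Conv S x → b ℚ.≤ dot a x
Conv-lowerBound a {b} above x (n , w , v , Sv , w≥0 , Σw≡1 , x≐) =
  subst₂ ℚ._≤_ (convexCombination-const w Σw≡1 b) (sym (trans (dot-cong a x≐) (dot-combination a w v)))
    (convexCombination-mono-≤ w≥0 (λ j → above (v j) (Sv j)))

Conv-hyperplane : ∀ {d} {S : PSet d} (a : Pt d) {b} → (∀ s → S s → dot a s ≡ b) →
  ∀ x → Conv S x → dot a x ≡ b
Conv-hyperplane a {b} on-plane x (n , w , v , Sv , w≥0 , Σw≡1 , x≐) =
  trans (dot-cong a x≐) (trans (dot-combination a w v)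
    (trans (sumℚ-cong (λ j → cong (w j ℚ.*_) (on-plane (v j) (Sv j)))) (convexCombination-const w Σw≡1 b)))

Conv-coordinate-bounds : ∀ {d} {S : PSet d} i {lo hi} → (∀ s → S s → lo ℚ.≤ s i × s i ℚ.≤ hi) →
  ∀ x → Conv S x → lo ℚ.≤ x i × x i ℚ.≤ hi
Conv-coordinate-bounds i {lo} {hi} bounds x (n , w , v , Sv , w≥0 , Σw≡1 , x≐) =
  subst₂ ℚ._≤_ (convexCombination-const w Σw≡1 lo) (sym (x≐ i))
    (convexCombination-mono-≤ w≥0 (λ j → proj₁ (bounds (v j) (Sv j)))) ,
  subst₂ ℚ._≤_ (sym (x≐ i)) (convexCombination-const w Σw≡1 hi)
    (convexCombination-mono-≤ w≥0 (λ j → proj₂ (bounds (v j) (Sv j))))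

Conv-face : ∀ {d} {S T : PSet d} (a : Pt d) {b} →
  (∀ s → S s → b ℚ.≤ dot a s) → (∀ s → S s → dot a s ≡ b → T s) → ∃ T →
  ∀ x → Conv S x → dot a x ≡ b → Conv T x
Conv-face {d} {S} {T} a {b} above tight (s₀ , Ts₀) x (n , w , v , Sv , w≥0 , Σw≡1 , x≐) dot≡b =
  n , w , v′ , (λ j → proj₁ (proj₂ (replace j))) , w≥0 , Σw≡1 , x≐′
  where
  excess : Fin n → ℚ
  excess j = w j ℚ.* (dot a (v j) ℚ.- b)
  Σexcess≡0 : sumℚ excess ≡ 0ℚ
  Σexcess≡0 = begin
    sumℚ excess                              ≡⟨ convexCombination-translate w Σw≡1 (λ j → dot a (v j)) b ⟩
    sumℚ (λ j → w j ℚ.* dot a (v j)) ℚ.- b   ≡⟨ cong (ℚ._- b) (dot-combination a w v) ⟨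
    dot a (combination w v) ℚ.- b            ≡⟨ cong (ℚ._- b) (dot-cong a x≐) ⟨
    dot a x ℚ.- b                            ≡⟨ cong (ℚ._- b) dot≡b ⟩
    b ℚ.- b                                  ≡⟨ ℚ.+-inverseʳ b ⟩
    0ℚ                                       ∎
    where open ≡-Reasoning
  excess≡0 : ∀ j → excess j ≡ 0ℚ
  excess≡0 = sumℚ-nonNeg-≡0 (λ j → *-nonNeg (w≥0 j) (≤⇒0≤- (above (v j) (Sv j)))) Σexcess≡0
  -- points of positive weight are tight; those of weight zero may be replaced by s₀
  replace : ∀ j → Σ (Pt d) λ y → T y × (∀ i → w j ℚ.* y i ≡ w j ℚ.* v j i)
  replace j = [ weightless , (λ tightⱼ → v j , tight (v j) (Sv j) (-≡0⇒≡ tightⱼ) , λ i → refl) ]′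
                (*≡0⇒≡0⊎≡0 (excess≡0 j))
    where
    weightless : w j ≡ 0ℚ → _
    weightless wⱼ≡0 = s₀ , Ts₀ , λ i →
      trans (cong (ℚ._* s₀ i) wⱼ≡0) (trans (ℚ.*-zeroˡ (s₀ i))
        (sym (trans (cong (ℚ._* v j i) wⱼ≡0) (ℚ.*-zeroˡ (v j i)))))
  v′ : Fin n → Pt d
  v′ j = proj₁ (replace j)
  x≐′ : x ≐ combination w v′
  x≐′ i = trans (x≐ i) (sumℚ-cong (λ j → sym (proj₂ (proj₂ (replace j)) i)))

dot-linear : ∀ {d} (a x y : Pt d) r s →
  dot a (λ i → r ℚ.* x i ℚ.+ s ℚ.* y i) ≡ r ℚ.* dot a x ℚ.+ s ℚ.* dot a y
dot-linear a x y r s = begin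
  sumℚ (λ i → a i ℚ.* (r ℚ.* x i ℚ.+ s ℚ.* y i))
    ≡⟨ sumℚ-cong (λ i → solve 5 (λ a r x s y → a :* (r :* x :+ s :* y) := r :* (a :* x) :+ s :* (a :* y))
                                  refl (a i) r (x i) s (y i)) ⟩
  sumℚ (λ i → r ℚ.* (a i ℚ.* x i) ℚ.+ s ℚ.* (a i ℚ.* y i))
    ≡⟨ sumℚ-distrib-+ (λ i → r ℚ.* (a i ℚ.* x i)) (λ i → s ℚ.* (a i ℚ.* y i)) ⟩
  sumℚ (λ i → r ℚ.* (a i ℚ.* x i)) ℚ.+ sumℚ (λ i → s ℚ.* (a i ℚ.* y i))
    ≡⟨ cong₂ ℚ._+_ (*-distribˡ-sumℚ r (λ i → a i ℚ.* x i)) (*-distribˡ-sumℚ s (λ i → a i ℚ.* y i)) ⟨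
  r ℚ.* dot a x ℚ.+ s ℚ.* dot a y ∎
  where
    open ≡-Reasoning
    open ℚ-Solver

corner-of-face⇒IsVertex : ∀ {d} {P : PSet d} (a : Pt d) {b} (lo hi s : Pt d) →
  (∀ x → P x → b ℚ.≤ dot a x) → P s → dot a s ≡ b →
  (∀ x → P x → dot a x ≡ b → ∀ i → lo i ℚ.≤ x i × x i ℚ.≤ hi i) →
  (∀ i → s i ≡ lo i ⊎ s i ≡ hi i) → IsVertex P s
corner-of-face⇒IsVertex {P = P} a {b} lo hi s above Ps dots≡b in-box corner = Ps , extreme
  where
  extreme : ∀ x y t → P x → P y → 0ℚ ℚ.< t → t ℚ.< 1ℚ →
    s ≐ (λ i → mix t (x i) (y i)) → (x ≐ s) × (y ≐ s)
  extreme x y t Px Py 0<t t<1 s≐ = (λ i → proj₁ (coordinate i)) , (λ i → proj₂ (coordinate i))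
    where
    mix-dot≡b : mix t (dot a x) (dot a y) ≡ b
    mix-dot≡b = trans (sym (dot-linear a x y t (1ℚ ℚ.- t))) (trans (sym (dot-cong a s≐)) dots≡b)
    tight : dot a x ≡ b × dot a y ≡ b
    tight = mix-lowerBound-≡ 0<t t<1 (above x Px) (above y Py) mix-dot≡b
    coordinate : ∀ i → x i ≡ s i × y i ≡ s i
    coordinate i = mix-endpoint 0<t t<1 (in-box x Px (proj₁ tight) i) (in-box y Py (proj₂ tight) i)
                     (corner i) (sym (s≐ i))

scaleShift : ∀ {d} → Pt d → Pt d → Pt d → Pt d
scaleShift σ τ x i = σ i ℚ.* x i ℚ.+ τ i

diagonal : ∀ {d} → Pt d → Fin d → Fin d → ℚ
diagonal σ i j = 𝟙 (δᵇ j i) ℚ.* σ j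

affMap-diagonal : ∀ {d} (σ τ x : Pt d) → affMap (diagonal σ) τ x ≐ scaleShift σ τ x
affMap-diagonal σ τ x i = cong (ℚ._+ τ i) (begin
  sumℚ (λ j → 𝟙 (δᵇ j i) ℚ.* σ j ℚ.* x j)    ≡⟨ sumℚ-cong (λ j → ℚ.*-assoc (𝟙 (δᵇ j i)) (σ j) (x j)) ⟩
  sumℚ (λ j → 𝟙 (δᵇ j i) ℚ.* (σ j ℚ.* x j))  ≡⟨ sumℚ-δᵇ (λ j → σ j ℚ.* x j) i ⟩
  σ i ℚ.* x i                                 ∎)
  where open ≡-Reasoning

combination-scaleShift : ∀ {m d} (σ τ : Pt d) (c : Fin m → ℚ) (v : Fin m → Pt d) i →
  combination c (λ j → scaleShift σ τ (v j)) i ≡ σ i ℚ.* combination c v i ℚ.+ τ i ℚ.* sumℚ c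
combination-scaleShift σ τ c v i = begin
  sumℚ (λ j → c j ℚ.* (σ i ℚ.* v j i ℚ.+ τ i))
    ≡⟨ sumℚ-cong (λ j → solve 4 (λ c s x t → c :* (s :* x :+ t) := s :* (c :* x) :+ t :* c)
                                  refl (c j) (σ i) (v j i) (τ i)) ⟩
  sumℚ (λ j → σ i ℚ.* (c j ℚ.* v j i) ℚ.+ τ i ℚ.* c j)
    ≡⟨ sumℚ-distrib-+ (λ j → σ i ℚ.* (c j ℚ.* v j i)) (λ j → τ i ℚ.* c j) ⟩
  sumℚ (λ j → σ i ℚ.* (c j ℚ.* v j i)) ℚ.+ sumℚ (λ j → τ i ℚ.* c j)
    ≡⟨ cong₂ ℚ._+_ (*-distribˡ-sumℚ (σ i) (λ j → c j ℚ.* v j i)) (*-distribˡ-sumℚ (τ i) c) ⟨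
  σ i ℚ.* combination c v i ℚ.+ τ i ℚ.* sumℚ c ∎
  where
    open ≡-Reasoning
    open ℚ-Solver

Conv-scaleShift : ∀ {d} {S T : PSet d} (σ τ : Pt d) → (∀ x → S x → T (scaleShift σ τ x)) →
  ∀ x → Conv S x → Conv T (scaleShift σ τ x)
Conv-scaleShift σ τ maps x (n , w , v , Sv , w≥0 , Σw≡1 , x≐) =
  n , w , (λ j → scaleShift σ τ (v j)) , (λ j → maps (v j) (Sv j)) , w≥0 , Σw≡1 , λ i → begin
    σ i ℚ.* x i ℚ.+ τ i
      ≡⟨ cong (λ xᵢ → σ i ℚ.* xᵢ ℚ.+ τ i) (x≐ i) ⟩
    σ i ℚ.* combination w v i ℚ.+ τ i
      ≡⟨ cong (σ i ℚ.* combination w v i ℚ.+_) (ℚ.*-identityʳ (τ i)) ⟨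
    σ i ℚ.* combination w v i ℚ.+ τ i ℚ.* 1ℚ
      ≡⟨ cong (λ t → σ i ℚ.* combination w v i ℚ.+ τ i ℚ.* t) Σw≡1 ⟨
    σ i ℚ.* combination w v i ℚ.+ τ i ℚ.* sumℚ w
      ≡⟨ combination-scaleShift σ τ w v i ⟨
    combination w (λ j → scaleShift σ τ (v j)) i ∎
  where open ≡-Reasoning

AffInd-scaleShift : ∀ {m d} (σ τ : Pt d) (v w : Fin m → Pt d) →
  (∀ j → w j ≐ scaleShift σ τ (v j)) → AffInd w → AffInd v
AffInd-scaleShift σ τ v w w≐ independent c Σc≡0 c-kills = independent c Σc≡0 λ i → begin
  combination c w i                                   ≡⟨ sumℚ-cong (λ j → cong (c j ℚ.*_) (w≐ j i)) ⟩
  combination c (λ j → scaleShift σ τ (v j)) i        ≡⟨ combination-scaleShift σ τ c v i ⟩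
  σ i ℚ.* combination c v i ℚ.+ τ i ℚ.* sumℚ c
    ≡⟨ cong₂ (λ s t → σ i ℚ.* s ℚ.+ τ i ℚ.* t) (c-kills i) Σc≡0 ⟩
  σ i ℚ.* 0ℚ ℚ.+ τ i ℚ.* 0ℚ
    ≡⟨ cong₂ ℚ._+_ (ℚ.*-zeroʳ (σ i)) (ℚ.*-zeroʳ (τ i)) ⟩
  0ℚ                                                  ∎
  where open ≡-Reasoning

module _ {d} (σ τ : Pt d) (σ≢0 : ∀ i → σ i ≢ 0ℚ) where

  σ⁻¹ τ⁻¹ : Pt d
  σ⁻¹ i = ℚ.1/_ (σ i) {{ℚ.≢-nonZero (σ≢0 i)}}
  τ⁻¹ i = ℚ.- (σ⁻¹ i ℚ.* τ i)

  σ*σ⁻¹≡1 : ∀ i → σ i ℚ.* σ⁻¹ i ≡ 1ℚ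
  σ*σ⁻¹≡1 i = ℚ.*-inverseʳ (σ i) {{ℚ.≢-nonZero (σ≢0 i)}}

  scaleShift-inverseˡ : ∀ x → scaleShift σ⁻¹ τ⁻¹ (scaleShift σ τ x) ≐ x
  scaleShift-inverseˡ x i = begin
    σ⁻¹ i ℚ.* (σ i ℚ.* x i ℚ.+ τ i) ℚ.+ ℚ.- (σ⁻¹ i ℚ.* τ i)
      ≡⟨ solve 4 (λ s s⁻¹ x t → s⁻¹ :* (s :* x :+ t) :+ :- (s⁻¹ :* t) := (s :* s⁻¹) :* x)
                 refl (σ i) (σ⁻¹ i) (x i) (τ i) ⟩
    (σ i ℚ.* σ⁻¹ i) ℚ.* x i   ≡⟨ cong (ℚ._* x i) (σ*σ⁻¹≡1 i) ⟩
    1ℚ ℚ.* x i                ≡⟨ ℚ.*-identityˡ (x i) ⟩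
    x i                       ∎
    where
      open ≡-Reasoning
      open ℚ-Solver

  scaleShift-inverseʳ : ∀ y → scaleShift σ τ (scaleShift σ⁻¹ τ⁻¹ y) ≐ y
  scaleShift-inverseʳ y i = begin
    σ i ℚ.* (σ⁻¹ i ℚ.* y i ℚ.+ ℚ.- (σ⁻¹ i ℚ.* τ i)) ℚ.+ τ i
      ≡⟨ solve 4 (λ s s⁻¹ y t → s :* (s⁻¹ :* y :+ :- (s⁻¹ :* t)) :+ t
                               := (s :* s⁻¹) :* y :+ (t :- (s :* s⁻¹) :* t))
                 refl (σ i) (σ⁻¹ i) (y i) (τ i) ⟩
    (σ i ℚ.* σ⁻¹ i) ℚ.* y i ℚ.+ (τ i ℚ.- (σ i ℚ.* σ⁻¹ i) ℚ.* τ i)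
      ≡⟨ cong (λ u → u ℚ.* y i ℚ.+ (τ i ℚ.- u ℚ.* τ i)) (σ*σ⁻¹≡1 i) ⟩
    1ℚ ℚ.* y i ℚ.+ (τ i ℚ.- 1ℚ ℚ.* τ i)
      ≡⟨ cong₂ (λ u v → u ℚ.+ (τ i ℚ.- v)) (ℚ.*-identityˡ (y i)) (ℚ.*-identityˡ (τ i)) ⟩
    y i ℚ.+ (τ i ℚ.- τ i)
      ≡⟨ cong (y i ℚ.+_) (ℚ.+-inverseʳ (τ i)) ⟩
    y i ℚ.+ 0ℚ
      ≡⟨ ℚ.+-identityʳ (y i) ⟩
    y i ∎
    where
      open ≡-Reasoning
      open ℚ-Solver

  AffEquiv-scaleShift : ∀ {S T : PSet d} → (∀ {x y} → x ≐ y → S y → S x) →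
    (∀ x → S x → T (scaleShift σ τ x)) → (∀ y → T y → ∃ λ x → S x × scaleShift σ τ x ≐ y) →
    AffEquiv (Conv S) (Conv T)
  AffEquiv-scaleShift {S} {T} S-resp-≐ maps onto =
    diagonal σ , τ , diagonal σ⁻¹ , τ⁻¹ ,
    (λ x i → trans (affMap∘affMap σ⁻¹ τ⁻¹ σ τ x i) (scaleShift-inverseˡ x i)) ,
    (λ y i → trans (affMap∘affMap σ τ σ⁻¹ τ⁻¹ y i) (scaleShift-inverseʳ y i)) ,
    (λ x hull → Conv-resp-≐ {S = T} (λ i → sym (affMap-diagonal σ τ x i))
                  (Conv-scaleShift {S = S} {T} σ τ maps x hull)) ,
    (λ y hull → scaleShift σ⁻¹ τ⁻¹ y , Conv-scaleShift {S = T} {S} σ⁻¹ τ⁻¹ pullback y hull ,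
                λ i → trans (affMap-diagonal σ τ _ i) (scaleShift-inverseʳ y i))
    where
    affMap∘affMap : ∀ σ₁ τ₁ σ₂ τ₂ x i →
      affMap (diagonal σ₁) τ₁ (affMap (diagonal σ₂) τ₂ x) i ≡ scaleShift σ₁ τ₁ (scaleShift σ₂ τ₂ x) i
    affMap∘affMap σ₁ τ₁ σ₂ τ₂ x i =
      trans (affMap-diagonal σ₁ τ₁ _ i) (cong (λ z → σ₁ i ℚ.* z ℚ.+ τ₁ i) (affMap-diagonal σ₂ τ₂ x i))
    pullback : ∀ y → T y → S (scaleShift σ⁻¹ τ⁻¹ y)
    pullback y Ty with onto y Ty
    ... | x , Sx , image≐y = S-resp-≐ (λ i →
      trans (cong (λ z → σ⁻¹ i ℚ.* z ℚ.+ τ⁻¹ i) (sym (image≐y i))) (scaleShift-inverseˡ x i)) Sx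

-- Factorisations of prime powers

∣-prime-power : ∀ {p} → Prime p → ∀ k {m} → m ∣ p ^ k → ∃ λ j → m ≡ p ^ j
∣-prime-power pp zero m∣1 = 0 , ∣1⇒≡1 m∣1
∣-prime-power {p} pp (suc k) {m} m∣p^[1+k] with p ∣? m
... | yes (divides m′ refl) =
  let j , m′≡p^j = ∣-prime-power pp k (*-cancelˡ-∣ p (subst (_∣ p * p ^ k) (ℕ.*-comm m′ p) m∣p^[1+k]))
  in suc j , trans (ℕ.*-comm m′ p) (cong (p *_) m′≡p^j)
  where instance _ = prime⇒nonZero pp
... | no p∤m = ∣-prime-power pp k (coprime-divisor m⊥p m∣p^[1+k])
  where
  m⊥p : Coprime m p
  m⊥p (i∣m , i∣p) with prime⇒irreducible pp i∣p
  ... | inj₁ i≡1 = i≡1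
  ... | inj₂ refl = contradiction i∣m p∤m

^-injective : ∀ {p} → 1 < p → ∀ {a b} → p ^ a ≡ p ^ b → a ≡ b
^-injective {p} 1<p {a} {b} p^a≡p^b with ℕ.<-cmp a b
... | tri< a<b _ _ = contradiction (ℕ.^-monoʳ-< p 1<p a<b) (ℕ.<-irrefl p^a≡p^b)
... | tri≈ _ a≡b _ = a≡b
... | tri> _ _ a>b = contradiction (ℕ.^-monoʳ-< p 1<p a>b) (ℕ.<-irrefl (sym p^a≡p^b))

prodℕ-cong : ∀ {n} {f g : Fin n → ℕ} → (∀ i → f i ≡ g i) → prodℕ f ≡ prodℕ g
prodℕ-cong {zero}  eq = refl
prodℕ-cong {suc n} eq = cong₂ _*_ (eq Fin.zero) (prodℕ-cong (λ i → eq (Fin.suc i)))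

∣-prodℕ : ∀ {n} (f : Fin n → ℕ) i → f i ∣ prodℕ f
∣-prodℕ f Fin.zero    = m∣m*n _
∣-prodℕ f (Fin.suc i) = ∣-trans (∣-prodℕ (λ j → f (Fin.suc j)) i) (n∣m*n (f Fin.zero))

prodℕ-^ : ∀ {n} p (β : Fin n → ℕ) → prodℕ (λ i → p ^ β i) ≡ p ^ sumℕ β
prodℕ-^ {zero}  p β = refl
prodℕ-^ {suc n} p β =
  trans (cong (p ^ β Fin.zero *_) (prodℕ-^ p (λ i → β (Fin.suc i)))) (sym (ℕ.^-distribˡ-+-* p (β Fin.zero) _))

factorisation-of-prime-power : ∀ {p n e} → Prime p → (v : Fin n → ℕ) → prodℕ v ≡ p ^ e →
  Σ (Fin n → ℕ) λ β → (∀ i → v i ≡ p ^ β i) × sumℕ β ≡ e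
factorisation-of-prime-power {p} {n} {e} pp v Πv≡p^e = β , v≡p^β , ^-injective 1<p p^Σβ≡p^e
  where
  1<p : 1 < p
  1<p = ℕ.nonTrivial⇒n>1 p {{prime⇒nonTrivial pp}}
  exponent : ∀ i → ∃ λ j → v i ≡ p ^ j
  exponent i = ∣-prime-power pp e (subst (v i ∣_) Πv≡p^e (∣-prodℕ v i))
  β : Fin n → ℕ
  β i = proj₁ (exponent i)
  v≡p^β : ∀ i → v i ≡ p ^ β i
  v≡p^β i = proj₂ (exponent i)
  p^Σβ≡p^e : p ^ sumℕ β ≡ p ^ e
  p^Σβ≡p^e = trans (sym (prodℕ-^ p β)) (trans (sym (prodℕ-cong v≡p^β)) Πv≡p^e)

-- The chord bound for p ^ γ

bernoulli-< : ∀ {q} → 1 ≤ q → ∀ k → 1 + (2 + k) * q < suc q ^ (2 + k)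
bernoulli-< {q} 1≤q zero = begin-strict
  1 + 2 * q
    <⟨ ℕ.m<m+n (1 + 2 * q) (ℕ.*-mono-≤ 1≤q 1≤q) ⟩
  1 + 2 * q + q * q
    ≡⟨ solve 1 (λ q → con 1 :+ con 2 :* q :+ q :* q := (con 1 :+ q) :* ((con 1 :+ q) :* con 1)) refl q ⟩
  suc q ^ 2 ∎
  where
    open ℕ.≤-Reasoning
    open ℕ-Solver
bernoulli-< {q} 1≤q (suc k) = begin-strict
  1 + (3 + k) * q
    ≡⟨ solve 2 (λ k q → con 1 :+ (con 3 :+ k) :* q := (con 1 :+ (con 2 :+ k) :* q) :+ q :* con 1) refl k q ⟩
  1 + (2 + k) * q + q * 1
    <⟨ ℕ.+-mono-<-≤ (bernoulli-< 1≤q k) (ℕ.*-monoʳ-≤ q (ℕ.m^n>0 (suc q) (2 + k))) ⟩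
  suc q ^ (2 + k) + q * suc q ^ (2 + k) ∎
  where
    open ℕ.≤-Reasoning
    open ℕ-Solver

module Chord {q} (1≤q : 1 ≤ q) (μ : ℕ) where

  p slope : ℕ
  p = suc q
  slope = q * p ^ μ

  -- p ^ γ compared with the chord through (μ , p ^ μ) and (μ + 1 , p ^ (μ + 1)); μ * slope is added
  -- to both sides so that no subtraction occurs
  data Position (γ : ℕ) : Set where
    on    : γ ≡ μ ⊎ γ ≡ suc μ → p ^ μ + γ * slope ≡ p ^ γ + μ * slope → Position γ
    above : p ^ μ + γ * slope < p ^ γ + μ * slope → Position γ

  position : ∀ γ → Position γ
  position γ with ℕ.compare γ μ
  ... | ℕ.equal .γ = on (inj₁ refl) refl
  ... | ℕ.greater .μ zero rewrite ℕ.+-identityʳ μ =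
    on (inj₂ refl)
       (solve 3 (λ P m q → P :+ (con 1 :+ m) :* (q :* P) := (P :+ q :* P) :+ m :* (q :* P)) refl (p ^ μ) μ q)
    where open ℕ-Solver
  ... | ℕ.greater .μ (suc k) = above (begin-strict
    p ^ μ + suc (μ + suc k) * slope
      ≡⟨ solve 4 (λ P m k q → P :+ (con 1 :+ (m :+ (con 1 :+ k))) :* (q :* P)
                             := m :* (q :* P) :+ P :* (con 1 :+ (con 2 :+ k) :* q))
               refl (p ^ μ) μ k q ⟩
    μ * slope + p ^ μ * (1 + (2 + k) * q)
      <⟨ ℕ.+-monoʳ-< (μ * slope) (ℕ.*-monoʳ-< (p ^ μ) {{ℕ.m^n≢0 p μ}} (bernoulli-< 1≤q k)) ⟩
    μ * slope + p ^ μ * p ^ (2 + k)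
      ≡⟨ ℕ.+-comm (μ * slope) _ ⟩
    p ^ μ * p ^ (2 + k) + μ * slope
      ≡⟨ cong (_+ μ * slope) (ℕ.^-distribˡ-+-* p μ (2 + k)) ⟨
    p ^ (μ + suc (suc k)) + μ * slope
      ≡⟨ cong (λ e → p ^ e + μ * slope) (ℕ.+-suc μ (suc k)) ⟩
    p ^ suc (μ + suc k) + μ * slope ∎)
    where
      open ℕ.≤-Reasoning
      open ℕ-Solver
  ... | ℕ.less .γ k = above (begin-strict
    p ^ μ + γ * slope                     <⟨ ℕ.+-monoʳ-< (p ^ μ) (ℕ.m<n+m (γ * slope) (ℕ.m^n>0 p γ)) ⟩
    p ^ μ + (p ^ γ + γ * slope)           ≤⟨ ℕ.+-monoˡ-≤ (p ^ γ + γ * slope) p^μ≤[1+k]*slope ⟩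
    suc k * slope + (p ^ γ + γ * slope)
      ≡⟨ solve 4 (λ k g P s → (con 1 :+ k) :* s :+ (P :+ g :* s) := P :+ (con 1 :+ (g :+ k)) :* s)
                 refl k γ (p ^ γ) slope ⟩
    p ^ γ + suc (γ + k) * slope           ∎)
    where
    open ℕ.≤-Reasoning
    open ℕ-Solver
    p^μ≤[1+k]*slope : p ^ μ ≤ suc k * slope
    p^μ≤[1+k]*slope = begin
      p ^ μ                ≡⟨ ℕ.*-identityˡ (p ^ μ) ⟨
      1 * p ^ μ            ≤⟨ ℕ.*-monoˡ-≤ (p ^ μ) (ℕ.*-mono-≤ (s≤s (z≤n {k})) 1≤q) ⟩
      (suc k * q) * p ^ μ  ≡⟨ ℕ.*-assoc (suc k) q (p ^ μ) ⟩
      suc k * slope        ∎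

  chord-≤ : ∀ γ → p ^ μ + γ * slope ≤ p ^ γ + μ * slope
  chord-≤ γ with position γ
  ... | on _ eq  = ℕ.≤-reflexive eq
  ... | above lt = ℕ.<⇒≤ lt

  chord-≡⇒ : ∀ {γ} → p ^ μ + γ * slope ≡ p ^ γ + μ * slope → γ ≡ μ ⊎ γ ≡ suc μ
  chord-≡⇒ {γ} eq with position γ
  ... | on γ≡μ∨1+μ _ = γ≡μ∨1+μ
  ... | above lt     = contradiction eq (ℕ.<⇒≢ lt)

  ^-chord : ∀ b → p ^ (μ + b2n b) ≡ p ^ μ + b2n b * slope
  ^-chord false = trans (cong (p ^_) (ℕ.+-identityʳ μ)) (sym (ℕ.+-identityʳ (p ^ μ)))
  ^-chord true  = trans (cong (p ^_) (ℕ.+-comm μ 1)) (cong (p ^ μ +_) (sym (ℕ.+-identityʳ slope)))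

  module _ {d l : ℕ} (l≤d : l ≤ d) where

    bound : ℕ
    bound = l * p ^ (μ + 1) + (d ∸ l) * p ^ μ

    bound≡ : bound ≡ d * p ^ μ + l * slope
    bound≡ = begin
      l * p ^ (μ + 1) + (d ∸ l) * p ^ μ
        ≡⟨ cong (λ e → l * p ^ e + (d ∸ l) * p ^ μ) (ℕ.+-comm μ 1) ⟩
      l * (p ^ μ + q * p ^ μ) + (d ∸ l) * p ^ μ
        ≡⟨ solve 4 (λ l P q r → l :* (P :+ q :* P) :+ r :* P := (r :+ l) :* P :+ l :* (q :* P))
                   refl l (p ^ μ) q (d ∸ l) ⟩
      ((d ∸ l) + l) * p ^ μ + l * slope
        ≡⟨ cong (λ n → n * p ^ μ + l * slope) (ℕ.m∸n+n≡m l≤d) ⟩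
      d * p ^ μ + l * slope ∎
      where
        open ≡-Reasoning
        open ℕ-Solver

    module _ (γ : Fin d → ℕ) (Σγ≡ : sumℕ γ ≡ μ * d + l) where

      sum-chord : sumℕ (λ i → p ^ μ + γ i * slope) ≡ bound + d * (μ * slope)
      sum-chord = begin
        sumℕ (λ i → p ^ μ + γ i * slope)
          ≡⟨ sumℕ-distrib-+ (λ _ → p ^ μ) (λ i → γ i * slope) ⟩
        sumℕ {d} (λ _ → p ^ μ) + sumℕ (λ i → γ i * slope)
          ≡⟨ cong₂ _+_ (sumℕ-const d (p ^ μ)) (sym (*-distribʳ-sumℕ slope γ)) ⟩
        d * p ^ μ + sumℕ γ * slope
          ≡⟨ cong (λ s → d * p ^ μ + s * slope) Σγ≡ ⟩
        d * p ^ μ + (μ * d + l) * slope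
          ≡⟨ solve 5 (λ d P m l s → d :* P :+ (m :* d :+ l) :* s := (d :* P :+ l :* s) :+ d :* (m :* s))
                     refl d (p ^ μ) μ l slope ⟩
        (d * p ^ μ + l * slope) + d * (μ * slope)
          ≡⟨ cong (_+ d * (μ * slope)) bound≡ ⟨
        bound + d * (μ * slope) ∎
        where
          open ≡-Reasoning
          open ℕ-Solver

      sum-power : sumℕ (λ i → p ^ γ i + μ * slope) ≡ sumℕ (λ i → p ^ γ i) + d * (μ * slope)
      sum-power = trans (sumℕ-distrib-+ (λ i → p ^ γ i) (λ _ → μ * slope))
                        (cong (sumℕ (λ i → p ^ γ i) +_) (sumℕ-const d (μ * slope)))

      bound≤sum-power : bound ≤ sumℕ (λ i → p ^ γ i)
      bound≤sum-power = ℕ.+-cancelʳ-≤ (d * (μ * slope)) _ _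
        (subst₂ _≤_ sum-chord sum-power (sumℕ-mono-≤ (λ i → chord-≤ (γ i))))

      bound≡sum-power⇒ : sumℕ (λ i → p ^ γ i) ≡ bound → ∀ i → γ i ≡ μ ⊎ γ i ≡ suc μ
      bound≡sum-power⇒ eq i = chord-≡⇒ (sumℕ-mono-≤-≡⇒≡ (λ i → chord-≤ (γ i)) sums≡ i)
        where
        sums≡ : sumℕ (λ i → p ^ μ + γ i * slope) ≡ sumℕ (λ i → p ^ γ i + μ * slope)
        sums≡ = trans sum-chord (trans (cong (_+ d * (μ * slope)) (sym eq)) (sym sum-power))

    sum-power-bits : ∀ (ε : Fin d → Bool) → count ε ≡ l → sumℕ (λ i → p ^ (μ + b2n (ε i))) ≡ bound
    sum-power-bits ε #ε≡l = begin
      sumℕ (λ i → p ^ (μ + b2n (ε i)))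
        ≡⟨ sumℕ-cong (λ i → ^-chord (ε i)) ⟩
      sumℕ (λ i → p ^ μ + b2n (ε i) * slope)
        ≡⟨ sumℕ-distrib-+ (λ _ → p ^ μ) (λ i → b2n (ε i) * slope) ⟩
      sumℕ {d} (λ _ → p ^ μ) + sumℕ (λ i → b2n (ε i) * slope)
        ≡⟨ cong₂ _+_ (sumℕ-const d (p ^ μ)) (sym (*-distribʳ-sumℕ slope (λ i → b2n (ε i)))) ⟩
      d * p ^ μ + count ε * slope
        ≡⟨ cong (λ n → d * p ^ μ + n * slope) #ε≡l ⟩
      d * p ^ μ + l * slope
        ≡⟨ bound≡ ⟨
      bound ∎
      where open ≡-Reasoning

-- The hypersimplex

HypersimplexVertex : (d l : ℕ) → PSet d
HypersimplexVertex d l x = Σ (Fin d → Bool) λ ε → (count ε ≡ l) × (x ≐ (λ i → 𝟙 (ε i)))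

<⇒<ᵇ≡true : ∀ {m n} → m < n → (m <ᵇ n) ≡ true
<⇒<ᵇ≡true {zero}  (s≤s _)   = refl
<⇒<ᵇ≡true {suc m} (s≤s m<n) = <⇒<ᵇ≡true m<n

≤⇒<ᵇ≡false : ∀ {m n} → n ≤ m → (m <ᵇ n) ≡ false
≤⇒<ᵇ≡false {n = zero}  z≤n       = refl
≤⇒<ᵇ≡false {n = suc n} (s≤s n≤m) = ≤⇒<ᵇ≡false n≤m

count-toggle-inside : ∀ {n} (j : Fin n) {L} → L ≤ n → toℕ j < L →
  count (λ i → δᵇ j i xor initialSegment L i) ≡ L ∸ 1
count-toggle-inside {n} j {L} L≤n j<L = ℕ.+-cancelʳ-≡ 1 _ _ (begin
  count toggled + 1                         ≡⟨ cong (λ b → count toggled + b2n b) j∈segment ⟨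
  count toggled + b2n (segment j)           ≡⟨ count-toggle j segment ⟩
  count segment + b2n (not (segment j))     ≡⟨ cong (λ b → count segment + b2n (not b)) j∈segment ⟩
  count segment + 0                         ≡⟨ ℕ.+-identityʳ _ ⟩
  count segment                               ≡⟨ count-initialSegment L L≤n ⟩
  L                                           ≡⟨ ℕ.m∸n+n≡m (ℕ.≤-trans (s≤s z≤n) j<L) ⟨
  L ∸ 1 + 1                                 ∎)
  where
  open ≡-Reasoning
  segment toggled : Fin n → Bool
  segment = initialSegment L
  toggled i = δᵇ j i xor segment i
  j∈segment : segment j ≡ true
  j∈segment = <⇒<ᵇ≡true j<L

count-toggle-outside : ∀ {n} (j : Fin n) {L} → L ≤ n → L ≤ toℕ j →
  count (λ i → δᵇ j i xor initialSegment L i) ≡ suc L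
count-toggle-outside {n} j {L} L≤n L≤j = begin
  count toggled                               ≡⟨ ℕ.+-identityʳ _ ⟨
  count toggled + 0                         ≡⟨ cong (λ b → count toggled + b2n b) j∉segment ⟨
  count toggled + b2n (segment j)           ≡⟨ count-toggle j segment ⟩
  count segment + b2n (not (segment j))     ≡⟨ cong (λ b → count segment + b2n (not b)) j∉segment ⟩
  count segment + 1                         ≡⟨ cong (_+ 1) (count-initialSegment L L≤n) ⟩
  L + 1                                     ≡⟨ ℕ.+-comm L 1 ⟩
  suc L                                       ∎
  where
  open ≡-Reasoning
  segment toggled : Fin n → Bool
  segment = initialSegment L
  toggled i = δᵇ j i xor segment i
  j∉segment : segment j ≡ false
  j∉segment = ≤⇒<ᵇ≡false L≤j

-- d affinely independent vertices of Δ(l): the indicators of {0..l} ∖ {j} for j ≤ l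
-- and of {0..l-2} ∪ {j} for j > l
module HypersimplexBasis {d l} (1≤l : 1 ≤ l) (l<d : l < d) where

  lengthFor : ∀ {j} → j ≤ l ⊎ l < j → ℕ
  lengthFor (inj₁ _) = suc l
  lengthFor (inj₂ _) = l ∸ 1

  segmentLength : Fin d → ℕ
  segmentLength j = lengthFor (ℕ.≤-<-connex (toℕ j) l)

  basis : Fin d → Fin d → Bool
  basis j i = δᵇ j i xor initialSegment (segmentLength j) i

  count-basis : ∀ j → count (basis j) ≡ l
  count-basis j = count-for (ℕ.≤-<-connex (toℕ j) l)
    where
    count-for : (side : toℕ j ≤ l ⊎ l < toℕ j) →
      count (λ i → δᵇ j i xor initialSegment (lengthFor side) i) ≡ l
    count-for (inj₁ j≤l) = count-toggle-inside j l<d (s≤s j≤l)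
    count-for (inj₂ l<j) =
      trans (count-toggle-outside j (ℕ.≤-trans l∸1≤l (ℕ.<⇒≤ l<d)) (ℕ.≤-trans l∸1≤l (ℕ.<⇒≤ l<j)))
            (ℕ.suc-pred l {{ℕ.>-nonZero 1≤l}})
      where l∸1≤l = ℕ.m∸n≤m l 1

  segmentLength≤1+l : ∀ j → segmentLength j ≤ suc l
  segmentLength≤1+l j = bound (ℕ.≤-<-connex (toℕ j) l)
    where
    bound : (side : toℕ j ≤ l ⊎ l < toℕ j) → lengthFor side ≤ suc l
    bound (inj₁ _) = ℕ.≤-refl
    bound (inj₂ _) = ℕ.≤-trans (ℕ.m∸n≤m l 1) (ℕ.n≤1+n l)

  segmentLength-low : ∀ {j} → toℕ j ≤ l → segmentLength j ≡ suc l
  segmentLength-low {j} j≤l = low (ℕ.≤-<-connex (toℕ j) l)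
    where
    low : (side : toℕ j ≤ l ⊎ l < toℕ j) → lengthFor side ≡ suc l
    low (inj₁ _)   = refl
    low (inj₂ l<j) = contradiction j≤l (ℕ.<⇒≱ l<j)

  basis-high : ∀ j {i} → l < toℕ i → basis j i ≡ δᵇ j i
  basis-high j {i} l<i =
    trans (cong (δᵇ j i xor_) (≤⇒<ᵇ≡false (ℕ.≤-trans (segmentLength≤1+l j) l<i)))
          (Bool.xor-identityʳ (δᵇ j i))

  basis-low : ∀ {j i} → toℕ j ≤ l → toℕ i ≤ l → basis j i ≡ not (δᵇ j i)
  basis-low {j} {i} j≤l i≤l =
    trans (cong (λ L → δᵇ j i xor initialSegment L i) (segmentLength-low j≤l))
      (trans (cong (δᵇ j i xor_) (<⇒<ᵇ≡true (s≤s i≤l))) (Bool.xor-comm (δᵇ j i) true))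

  basis-independent : AffInd (λ j i → 𝟙 (basis j i))
  basis-independent c Σc≡0 c-kills i = [ low , high ]′ (ℕ.≤-<-connex (toℕ i) l)
    where
    high : ∀ {i} → l < toℕ i → c i ≡ 0ℚ
    high {i} l<i = begin
      c i                                  ≡⟨ sumℚ-δᵇ c i ⟨
      sumℚ (λ j → 𝟙 (δᵇ j i) ℚ.* c j)      ≡⟨ sumℚ-cong (λ j → trans (ℚ.*-comm _ (c j))
                                                (cong (λ b → c j ℚ.* 𝟙 b) (sym (basis-high j l<i)))) ⟩
      sumℚ (λ j → c j ℚ.* 𝟙 (basis j i))   ≡⟨ c-kills i ⟩
      0ℚ                                   ∎
      where open ≡-Reasoning
    low : ∀ {i} → toℕ i ≤ l → c i ≡ 0ℚ
    low {i} i≤l = sym (-≡0⇒≡ (begin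
      0ℚ ℚ.- c i
        ≡⟨ cong₂ ℚ._-_ Σc≡0 (sumℚ-δᵇ c i) ⟨
      sumℚ c ℚ.- sumℚ (λ j → 𝟙 (δᵇ j i) ℚ.* c j)
        ≡⟨ cong (sumℚ c ℚ.+_) (neg-distrib-sumℚ (λ j → 𝟙 (δᵇ j i) ℚ.* c j)) ⟩
      sumℚ c ℚ.+ sumℚ (λ j → ℚ.- (𝟙 (δᵇ j i) ℚ.* c j))
        ≡⟨ sumℚ-distrib-+ c (λ j → ℚ.- (𝟙 (δᵇ j i) ℚ.* c j)) ⟨
      sumℚ (λ j → c j ℚ.- 𝟙 (δᵇ j i) ℚ.* c j)
        ≡⟨ sumℚ-cong term ⟨
      sumℚ (λ j → c j ℚ.* 𝟙 (basis j i))
        ≡⟨ c-kills i ⟩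
      0ℚ ∎))
      where
      open ≡-Reasoning
      open ℚ-Solver
      term : ∀ j → c j ℚ.* 𝟙 (basis j i) ≡ c j ℚ.- 𝟙 (δᵇ j i) ℚ.* c j
      term j = [ low-row , high-row ]′ (ℕ.≤-<-connex (toℕ j) l)
        where
        low-row : toℕ j ≤ l → c j ℚ.* 𝟙 (basis j i) ≡ c j ℚ.- 𝟙 (δᵇ j i) ℚ.* c j
        low-row j≤l = begin
          c j ℚ.* 𝟙 (basis j i)               ≡⟨ cong (λ b → c j ℚ.* 𝟙 b) (basis-low j≤l i≤l) ⟩
          c j ℚ.* 𝟙 (not (δᵇ j i))            ≡⟨ cong (c j ℚ.*_) (𝟙-not (δᵇ j i)) ⟩
          c j ℚ.* (1ℚ ℚ.- 𝟙 (δᵇ j i))         ≡⟨ solve 2 (λ c δ → c :* (con 1ℚ :- δ) := c :- δ :* c)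
                                                         refl (c j) (𝟙 (δᵇ j i)) ⟩
          c j ℚ.- 𝟙 (δᵇ j i) ℚ.* c j          ∎
        high-row : l < toℕ j → c j ℚ.* 𝟙 (basis j i) ≡ c j ℚ.- 𝟙 (δᵇ j i) ℚ.* c j
        high-row l<j = subst (λ x → x ℚ.* 𝟙 (basis j i) ≡ x ℚ.- 𝟙 (δᵇ j i) ℚ.* x) (sym (high l<j))
          (trans (ℚ.*-zeroˡ (𝟙 (basis j i))) (sym (cong (λ x → 0ℚ ℚ.- x) (ℚ.*-zeroʳ (𝟙 (δᵇ j i))))))

-- The facet

module Facet {q} (1≤q : 1 ≤ q) (p-prime : Prime (suc q)) {k e l : ℕ} (2≤e : 2 ≤ e) (1≤l : 1 ≤ l)
  (l<d : l < 2 + k) (α : Fin (2 + k) → ℕ) (α∈ℛ : InR (2 + k) e l α)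
  (μ : ℕ) (μ-def : μ * (2 + k) + l ≡ e + sumℕ α) where

  open Chord 1≤q μ

  d : ℕ
  d = 2 + k

  l≤d : l ≤ d
  l≤d = ℕ.<⇒≤ l<d

  B : ℕ
  B = bound l≤d

  a : Pt d
  a i = ℕ→ℚ (p ^ α i)

  b : ℚ
  b = ℕ→ℚ B

  α≤μ : ∀ i → α i ≤ μ
  α≤μ i = ℕ.≤-pred (ℕ.*-cancelʳ-< d (α i) (suc μ) (begin-strict
    α i * d      ≡⟨ ℕ.*-comm (α i) d ⟩
    d * α i      <⟨ proj₁ (proj₂ α∈ℛ) i ⟩
    e + sumℕ α   ≡⟨ μ-def ⟨
    μ * d + l    <⟨ ℕ.+-monoʳ-< (μ * d) l<d ⟩
    μ * d + d    ≡⟨ ℕ.+-comm (μ * d) d ⟩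
    suc μ * d    ∎))
    where open ℕ.≤-Reasoning

  dot-power : ∀ (β : Fin d → ℕ) {x} → x ≐ (λ i → ℕ→ℚ (p ^ β i)) →
    dot a x ≡ ℕ→ℚ (sumℕ (λ i → p ^ (α i + β i)))
  dot-power β {x} x≐ = begin
    dot a x
      ≡⟨ dot-cong a x≐ ⟩
    sumℚ (λ i → ℕ→ℚ (p ^ α i) ℚ.* ℕ→ℚ (p ^ β i))
      ≡⟨ sumℚ-cong (λ i → ℕ→ℚ-homo-* (p ^ α i) (p ^ β i)) ⟨
    sumℚ (λ i → ℕ→ℚ (p ^ α i * p ^ β i))
      ≡⟨ sumℚ-cong (λ i → cong ℕ→ℚ (ℕ.^-distribˡ-+-* p (α i) (β i))) ⟨
    sumℚ (λ i → ℕ→ℚ (p ^ (α i + β i)))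
      ≡⟨ ℕ→ℚ-homo-sum (λ i → p ^ (α i + β i)) ⟨
    ℕ→ℚ (sumℕ (λ i → p ^ (α i + β i))) ∎
    where open ≡-Reasoning

  sum-α+β : ∀ (β : Fin d → ℕ) → sumℕ β ≡ e → sumℕ (λ i → α i + β i) ≡ μ * d + l
  sum-α+β β Σβ≡e =
    trans (sumℕ-distrib-+ α β) (trans (cong (sumℕ α +_) Σβ≡e) (trans (ℕ.+-comm (sumℕ α) e) (sym μ-def)))

  exponents : ∀ {x} → VecFact (p ^ e) d x →
    Σ (Fin d → ℕ) λ β → x ≐ (λ i → ℕ→ℚ (p ^ β i)) × sumℕ β ≡ e
  exponents {x} (v , _ , Πv≡p^e , x≐v) with factorisation-of-prime-power p-prime v Πv≡p^e
  ... | β , v≡p^β , Σβ≡e = β , (λ i → trans (x≐v i) (cong ℕ→ℚ (v≡p^β i))) , Σβ≡e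

  VecFact-above : ∀ x → VecFact (p ^ e) d x → b ℚ.≤ dot a x
  VecFact-above x vf = let β , x≐ , Σβ≡e = exponents vf in
    subst (b ℚ.≤_) (sym (dot-power β x≐))
      (ℕ→ℚ-mono-≤ (bound≤sum-power l≤d (λ i → α i + β i) (sum-α+β β Σβ≡e)))

  exponent : (Fin d → Bool) → Fin d → ℕ
  exponent ε i = μ ∸ α i + b2n (ε i)

  α+exponent : ∀ ε i → α i + exponent ε i ≡ μ + b2n (ε i)
  α+exponent ε i = trans (sym (ℕ.+-assoc (α i) (μ ∸ α i) _)) (cong (_+ b2n (ε i)) (ℕ.m+[n∸m]≡n (α≤μ i)))

  sum-μ+bits : ∀ ε → sumℕ (λ i → μ + b2n (ε i)) ≡ μ * d + count ε
  sum-μ+bits ε =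
    trans (sumℕ-distrib-+ {d} (λ _ → μ) (λ i → b2n (ε i)))
          (cong (_+ count ε) (trans (sumℕ-const d μ) (ℕ.*-comm d μ)))

  sum-exponent : ∀ ε → count ε ≡ l → sumℕ (exponent ε) ≡ e
  sum-exponent ε #ε≡l = ℕ.+-cancelʳ-≡ (sumℕ α) _ _ (begin
    sumℕ (exponent ε) + sumℕ α              ≡⟨ ℕ.+-comm (sumℕ (exponent ε)) (sumℕ α) ⟩
    sumℕ α + sumℕ (exponent ε)              ≡⟨ sumℕ-distrib-+ α (exponent ε) ⟨
    sumℕ (λ i → α i + exponent ε i)         ≡⟨ sumℕ-cong (α+exponent ε) ⟩
    sumℕ (λ i → μ + b2n (ε i))              ≡⟨ sum-μ+bits ε ⟩
    μ * d + count ε                         ≡⟨ cong (μ * d +_) #ε≡l ⟩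
    μ * d + l                               ≡⟨ μ-def ⟩
    e + sumℕ α                              ∎)
    where open ≡-Reasoning

  Sα-dot : ∀ x → Sα p l μ α x → dot a x ≡ b
  Sα-dot x (ε , #ε≡l , x≐) = trans (dot-power (exponent ε) x≐)
    (cong ℕ→ℚ (trans (sumℕ-cong (λ i → cong (p ^_) (α+exponent ε i))) (sum-power-bits l≤d ε #ε≡l)))

  Sα⊆VecFact : ∀ x → Sα p l μ α x → VecFact (p ^ e) d x
  Sα⊆VecFact x (ε , #ε≡l , x≐) =
    (λ i → p ^ exponent ε i) , (λ i → ℕ.m^n>0 p (exponent ε i)) ,
    trans (prodℕ-^ p (exponent ε)) (cong (p ^_) (sum-exponent ε #ε≡l)) , x≐

  chord-bit : ∀ {m} → m ≡ μ ⊎ m ≡ suc μ → Bool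
  chord-bit (inj₁ _) = false
  chord-bit (inj₂ _) = true

  chord-bit-spec : ∀ {m} (on-chord : m ≡ μ ⊎ m ≡ suc μ) → m ≡ μ + b2n (chord-bit on-chord)
  chord-bit-spec (inj₁ refl) = sym (ℕ.+-identityʳ μ)
  chord-bit-spec (inj₂ refl) = ℕ.+-comm 1 μ

  power-tight⇒Sα : ∀ (β : Fin d → ℕ) {x} → x ≐ (λ i → ℕ→ℚ (p ^ β i)) → sumℕ β ≡ e →
    dot a x ≡ b → Sα p l μ α x
  power-tight⇒Sα β x≐ Σβ≡e dot≡b =
    ε , #ε≡l , λ i → trans (x≐ i) (cong (λ k → ℕ→ℚ (p ^ k)) (β≡exponent i))
    where
    on-chord : ∀ i → α i + β i ≡ μ ⊎ α i + β i ≡ suc μ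
    on-chord = bound≡sum-power⇒ l≤d (λ i → α i + β i) (sum-α+β β Σβ≡e)
                 (ℕ→ℚ-injective (trans (sym (dot-power β x≐)) dot≡b))
    ε : Fin d → Bool
    ε i = chord-bit (on-chord i)
    #ε≡l : count ε ≡ l
    #ε≡l = ℕ.+-cancelˡ-≡ (μ * d) _ _ (begin
      μ * d + count ε                       ≡⟨ sum-μ+bits ε ⟨
      sumℕ (λ i → μ + b2n (ε i))            ≡⟨ sumℕ-cong (λ i → chord-bit-spec (on-chord i)) ⟨
      sumℕ (λ i → α i + β i)                ≡⟨ sum-α+β β Σβ≡e ⟩
      μ * d + l                             ∎)
      where open ≡-Reasoning
    β≡exponent : ∀ i → β i ≡ exponent ε i
    β≡exponent i = ℕ.+-cancelˡ-≡ (α i) _ _ (trans (chord-bit-spec (on-chord i)) (sym (α+exponent ε i)))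

  VecFact-tight⇒Sα : ∀ x → VecFact (p ^ e) d x → dot a x ≡ b → Sα p l μ α x
  VecFact-tight⇒Sα x vf = let β , x≐ , Σβ≡e = exponents vf in power-tight⇒Sα β x≐ Σβ≡e

  𝒫-above : ∀ x → 𝒫 (p ^ e) d x → b ℚ.≤ dot a x
  𝒫-above = Conv-lowerBound a VecFact-above

  SαPoint : (Fin d → Bool) → Pt d
  SαPoint ε i = ℕ→ℚ (p ^ exponent ε i)

  open HypersimplexBasis 1≤l l<d

  basisPoint : Fin d → Pt d
  basisPoint j = SαPoint (basis j)

  Sα-basisPoint : ∀ j → Sα p l μ α (basisPoint j)
  Sα-basisPoint j = basis j , count-basis j , λ i → refl

  𝒫-tight⇒Conv-Sα : ∀ x → 𝒫 (p ^ e) d x → dot a x ≡ b → Conv (Sα p l μ α) x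
  𝒫-tight⇒Conv-Sα = Conv-face a VecFact-above VecFact-tight⇒Sα (basisPoint Fin.zero , Sα-basisPoint Fin.zero)

  face : IsFace (Conv (Sα p l μ α)) (𝒫 (p ^ e) d)
  face = a , b , 𝒫-above ,
    (λ x hull → Conv-mono Sα⊆VecFact x hull , Conv-hyperplane a Sα-dot x hull) ,
    𝒫-tight⇒Conv-Sα

  -- the + 0 makes both bounds match μ ∸ α i + b2n (ε i) definitionally once ε i is known
  lower upper : Pt d
  lower i = ℕ→ℚ (p ^ (μ ∸ α i + 0))
  upper i = ℕ→ℚ (p ^ (μ ∸ α i + 1))

  bit-bounds : ∀ m c →
    ℕ→ℚ (p ^ (m + 0)) ℚ.≤ ℕ→ℚ (p ^ (m + b2n c)) × ℕ→ℚ (p ^ (m + b2n c)) ℚ.≤ ℕ→ℚ (p ^ (m + 1))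
  bit-bounds m false = ℚ.≤-refl , ℕ→ℚ-mono-≤ (ℕ.^-monoʳ-≤ p (ℕ.+-monoʳ-≤ m z≤n))
  bit-bounds m true  = ℕ→ℚ-mono-≤ (ℕ.^-monoʳ-≤ p (ℕ.+-monoʳ-≤ m z≤n)) , ℚ.≤-refl

  bit-endpoint : ∀ m c →
    ℕ→ℚ (p ^ (m + b2n c)) ≡ ℕ→ℚ (p ^ (m + 0)) ⊎ ℕ→ℚ (p ^ (m + b2n c)) ≡ ℕ→ℚ (p ^ (m + 1))
  bit-endpoint m false = inj₁ refl
  bit-endpoint m true  = inj₂ refl

  Sα-in-box : ∀ i s → Sα p l μ α s → lower i ℚ.≤ s i × s i ℚ.≤ upper i
  Sα-in-box i s (ε , _ , s≐) rewrite s≐ i = bit-bounds (μ ∸ α i) (ε i)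

  Sα-corner : ∀ s → Sα p l μ α s → ∀ i → s i ≡ lower i ⊎ s i ≡ upper i
  Sα-corner s (ε , _ , s≐) i rewrite s≐ i = bit-endpoint (μ ∸ α i) (ε i)

  Sα-vertex : ∀ s → Sα p l μ α s → IsVertex (𝒫 (p ^ e) d) s
  Sα-vertex s Ss = corner-of-face⇒IsVertex a lower upper s 𝒫-above
    (⊆-Conv {S = VecFact (p ^ e) d} s (Sα⊆VecFact s Ss)) (Sα-dot s Ss)
    (λ x Px dot≡b i → Conv-coordinate-bounds i (Sα-in-box i) x (𝒫-tight⇒Conv-Sα x Px dot≡b))
    (Sα-corner s Ss)

  slope≢0 : ℕ→ℚ slope ≢ 0ℚ
  slope≢0 = ℕ→ℚ-≢0 (ℕ.*-mono-≤ 1≤q (ℕ.m^n>0 p μ))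

  slope⁻¹ : ℚ
  slope⁻¹ = ℚ.1/_ (ℕ→ℚ slope) {{ℚ.≢-nonZero slope≢0}}

  -- x ↦ (a i * x i - p ^ μ) / slope, sending Sα onto the vertices of Δ(l)
  σ τ : Pt d
  σ i = a i ℚ.* slope⁻¹
  τ i = ℚ.- (ℕ→ℚ (p ^ μ) ℚ.* slope⁻¹)

  σ≢0 : ∀ i → σ i ≢ 0ℚ
  σ≢0 i = *-≢0 (ℕ→ℚ-≢0 (ℕ.m^n>0 p (α i))) (1/-≢0 slope≢0)

  scaleShift-SαPoint : ∀ ε → scaleShift σ τ (SαPoint ε) ≐ (λ i → 𝟙 (ε i))
  scaleShift-SαPoint ε i = begin
    a i ℚ.* slope⁻¹ ℚ.* ℕ→ℚ (p ^ exponent ε i) ℚ.+ ℚ.- (P ℚ.* slope⁻¹)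
      ≡⟨ solve 4 (λ A S⁻¹ X P → A :* S⁻¹ :* X :+ :- (P :* S⁻¹) := (A :* X) :* S⁻¹ :+ :- (P :* S⁻¹))
                 refl (a i) slope⁻¹ (ℕ→ℚ (p ^ exponent ε i)) P ⟩
    a i ℚ.* ℕ→ℚ (p ^ exponent ε i) ℚ.* slope⁻¹ ℚ.+ ℚ.- (P ℚ.* slope⁻¹)
      ≡⟨ cong (λ y → y ℚ.* slope⁻¹ ℚ.+ ℚ.- (P ℚ.* slope⁻¹)) value ⟩
    (P ℚ.+ 𝟙 (ε i) ℚ.* ℕ→ℚ slope) ℚ.* slope⁻¹ ℚ.+ ℚ.- (P ℚ.* slope⁻¹)
      ≡⟨ solve 4 (λ P c S S⁻¹ → (P :+ c :* S) :* S⁻¹ :+ :- (P :* S⁻¹) := c :* (S :* S⁻¹))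
                 refl P (𝟙 (ε i)) (ℕ→ℚ slope) slope⁻¹ ⟩
    𝟙 (ε i) ℚ.* (ℕ→ℚ slope ℚ.* slope⁻¹)
      ≡⟨ cong (𝟙 (ε i) ℚ.*_) (ℚ.*-inverseʳ (ℕ→ℚ slope) {{ℚ.≢-nonZero slope≢0}}) ⟩
    𝟙 (ε i) ℚ.* 1ℚ
      ≡⟨ ℚ.*-identityʳ (𝟙 (ε i)) ⟩
    𝟙 (ε i) ∎
    where
    open ≡-Reasoning
    open ℚ-Solver
    P = ℕ→ℚ (p ^ μ)
    value : a i ℚ.* ℕ→ℚ (p ^ exponent ε i) ≡ P ℚ.+ 𝟙 (ε i) ℚ.* ℕ→ℚ slope
    value = begin
      ℕ→ℚ (p ^ α i) ℚ.* ℕ→ℚ (p ^ exponent ε i)   ≡⟨ ℕ→ℚ-homo-* (p ^ α i) _ ⟨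
      ℕ→ℚ (p ^ α i * p ^ exponent ε i)          ≡⟨ cong ℕ→ℚ (ℕ.^-distribˡ-+-* p (α i) _) ⟨
      ℕ→ℚ (p ^ (α i + exponent ε i))            ≡⟨ cong (λ m → ℕ→ℚ (p ^ m)) (α+exponent ε i) ⟩
      ℕ→ℚ (p ^ (μ + b2n (ε i)))                 ≡⟨ cong ℕ→ℚ (^-chord (ε i)) ⟩
      ℕ→ℚ (p ^ μ + b2n (ε i) * slope)           ≡⟨ ℕ→ℚ-homo-+ (p ^ μ) _ ⟩
      P ℚ.+ ℕ→ℚ (b2n (ε i) * slope)             ≡⟨ cong (P ℚ.+_) (ℕ→ℚ-homo-* (b2n (ε i)) slope) ⟩
      P ℚ.+ 𝟙 (ε i) ℚ.* ℕ→ℚ slope               ∎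

  affEquiv : AffEquiv (Conv (Sα p l μ α)) (Hypersimplex d l)
  affEquiv = AffEquiv-scaleShift σ τ σ≢0 {Sα p l μ α} {HypersimplexVertex d l}
    (λ { x≐y (ε , #ε≡l , y≐) → ε , #ε≡l , λ i → trans (x≐y i) (y≐ i) })
    (λ { x (ε , #ε≡l , x≐) → ε , #ε≡l , λ i →
         trans (cong (λ z → σ i ℚ.* z ℚ.+ τ i) (x≐ i)) (scaleShift-SαPoint ε i) })
    (λ { y (ε , #ε≡l , y≐) → SαPoint ε , (ε , #ε≡l , λ i → refl) , λ i →
         trans (scaleShift-SαPoint ε i) (sym (y≐ i)) })

  basisPoint-independent : AffInd basisPoint
  basisPoint-independent = AffInd-scaleShift σ τ basisPoint (λ j i → 𝟙 (basis j i))
    (λ j i → sym (scaleShift-SαPoint (basis j) i)) basis-independent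

  b≢0 : b ≢ 0ℚ
  b≢0 = ℕ→ℚ-≢0 (ℕ.≤-trans (ℕ.*-mono-≤ 1≤l (ℕ.m^n>0 p (μ + 1))) (ℕ.m≤m+n (l * p ^ (μ + 1)) _))

  dim-face : HasDim (Conv (Sα p l μ α)) (suc k)
  dim-face =
    (basisPoint , (λ j → ⊆-Conv {S = Sα p l μ α} (basisPoint j) (Sα-basisPoint j)) , basisPoint-independent) ,
    λ v hull → hyperplane⇒affinelyDependent a b≢0 v (λ j → Conv-hyperplane a Sα-dot (v j) (hull j))

  -- p ^ e placed at i₁ ≠ i₀, where α i₀ = 0: on the face, γ i₀ = 0 would force μ = 0, yet γ i₁ ≥ e ≥ 2
  i₀ i₁ : Fin d
  i₀ = proj₁ (proj₁ α∈ℛ)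
  i₁ = Fin.punchIn i₀ Fin.zero

  apex : Fin d → ℕ
  apex i = b2n (δᵇ i₁ i) * e

  sum-apex : sumℕ apex ≡ e
  sum-apex = trans (sym (*-distribʳ-sumℕ e (λ i → b2n (δᵇ i₁ i))))
                   (trans (cong (_* e) (count-δᵇ i₁)) (ℕ.*-identityˡ e))

  apexPoint : Pt d
  apexPoint i = ℕ→ℚ (p ^ apex i)

  apex-VecFact : VecFact (p ^ e) d apexPoint
  apex-VecFact = (λ i → p ^ apex i) , (λ i → ℕ.m^n>0 p (apex i)) ,
                 trans (prodℕ-^ p apex) (cong (p ^_) sum-apex) , λ i → refl

  apex-off-face : dot a apexPoint ≢ b
  apex-off-face dot≡b =
    contradiction (ℕ.≤-trans 2≤γ₁ (subst (γ i₁ ≤_) (cong suc μ≡0) (on-chord⇒≤ (on-chord i₁)))) λ { (s≤s ()) }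
    where
    γ : Fin d → ℕ
    γ i = α i + apex i
    on-chord : ∀ i → γ i ≡ μ ⊎ γ i ≡ suc μ
    on-chord = bound≡sum-power⇒ l≤d γ (sum-α+β apex sum-apex)
                 (ℕ→ℚ-injective (trans (sym (dot-power apex (λ i → refl))) dot≡b))
    on-chord⇒≤ : ∀ {m} → m ≡ μ ⊎ m ≡ suc μ → m ≤ suc μ
    on-chord⇒≤ (inj₁ refl) = ℕ.n≤1+n μ
    on-chord⇒≤ (inj₂ refl) = ℕ.≤-refl
    γ₀≡0 : γ i₀ ≡ 0
    γ₀≡0 = cong₂ _+_ (proj₂ (proj₁ α∈ℛ))
                     (cong (λ t → b2n t * e) (dec-false (i₁ Fin.≟ i₀) (Fin.punchInᵢ≢i i₀ Fin.zero)))
    μ≡0 : μ ≡ 0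
    μ≡0 = [ (λ γ₀≡μ → trans (sym γ₀≡μ) γ₀≡0)
          , (λ γ₀≡1+μ → contradiction (trans (sym γ₀≡1+μ) γ₀≡0) λ ()) ]′ (on-chord i₀)
    2≤γ₁ : 2 ≤ γ i₁
    2≤γ₁ = ℕ.≤-trans 2≤e (subst (_≤ γ i₁) apex₁≡e (ℕ.m≤n+m (apex i₁) (α i₁)))
      where
      apex₁≡e : apex i₁ ≡ e
      apex₁≡e = trans (cong (λ t → b2n t * e) (dec-true (i₁ Fin.≟ i₁) refl)) (ℕ.*-identityˡ e)

  dim-polytope : HasDim (𝒫 (p ^ e) d) d
  dim-polytope =
    ((apexPoint ∷ basisPoint) , in-𝒫 ,
     AffInd-∷ a apexPoint basisPoint (λ j → Sα-dot (basisPoint j) (Sα-basisPoint j))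
       apex-off-face basisPoint-independent) ,
    λ v _ → affinelyDependent v
    where
    in-𝒫 : ∀ j → 𝒫 (p ^ e) d ((apexPoint ∷ basisPoint) j)
    in-𝒫 Fin.zero    = ⊆-Conv {S = VecFact (p ^ e) d} apexPoint apex-VecFact
    in-𝒫 (Fin.suc j) = ⊆-Conv {S = VecFact (p ^ e) d} (basisPoint j) (Sα⊆VecFact (basisPoint j) (Sα-basisPoint j))

  facet : IsFacet (Conv (Sα p l μ α)) (𝒫 (p ^ e) d)
  facet = face , suc k , dim-polytope , dim-face

corollary3p4 : (p e d l : ℕ) → Prime p → 2 ≤ e → 2 ≤ d →
    1 ≤ l → l ≤ e ⊓ (d ∸ 1) →
    (α : Fin d → ℕ) → InR d e l α →
    (μ : ℕ) → μ * d + l ≡ e + sumℕ α →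
    ((∀ x → 𝒫 (p ^ e) d x →
        Data.Rational._≤_ (ℕ→ℚ (l * p ^ (μ + 1) + (d ∸ l) * p ^ μ))
          (dot (λ i → ℕ→ℚ (p ^ α i)) x))
     × (∀ s → Sα p l μ α s →
        (dot (λ i → ℕ→ℚ (p ^ α i)) s ≡ ℕ→ℚ (l * p ^ (μ + 1) + (d ∸ l) * p ^ μ))
        × IsVertex (𝒫 (p ^ e) d) s)
     × IsFacet (Conv (Sα p l μ α)) (𝒫 (p ^ e) d)
     × AffEquiv (Conv (Sα p l μ α)) (Hypersimplex d l))
corollary3p4 0       _ _ _ p-prime = contradiction (ℕ.nonTrivial⇒n>1 0 {{prime⇒nonTrivial p-prime}}) λ ()
corollary3p4 1       _ _ _ p-prime = contradiction (ℕ.nonTrivial⇒n>1 1 {{prime⇒nonTrivial p-prime}}) λ { (s≤s ()) }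
corollary3p4 (2+ q) e 0       l _ _ ()
corollary3p4 (2+ q) e 1       l _ _ (s≤s ())
corollary3p4 (2+ q) e (2+ k) l p-prime 2≤e _ 1≤l l≤e⊓[d-1] α α∈ℛ μ μ-def =
  𝒫-above , (λ s Ss → Sα-dot s Ss , Sα-vertex s Ss) , facet , affEquiv
  where open Facet (s≤s z≤n) p-prime 2≤e 1≤l (s≤s (ℕ.m≤n⊓o⇒m≤o e (suc k) l≤e⊓[d-1]))
                   α α∈ℛ μ μ-def
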